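{- Let $m\ge2$, let $k$ be a positive integer and let $v_a,v_b$ be any vertices. For integers $i$ let $B_i$ be the event that $d_m^i(v_a)\ge m\sqrt i/(4k)$ and $d_m^i(v_b)\ge m\sqrt i/(4k)$. For integers $j\le i$ let $A_{j,i}$ be the event that for at least one of the vertices $v_j,\dots,v_i$, its first edge is incident to $v_a$ and its second edge is incident to $v_b$. Then for all integers $i,j$ with $k^4\le i$ and $j\le i$, $$\mathbb{P}\bigl(\bar A_{i+1,2i}\bigm|\bar A_{j,i}\cap B_i\bigr)\le e^{ -\frac1{256k^2}}.$$
   Context: Preferential attachment process. For $m=1$: $G_1^1$ is a single vertex $v_1$ with one self-loop; for $t\ge2$, $G_1^t$ is obtained from $G_1^{t-1}$ by adding a vertex $v_t$ with one edge from $v_t$ to $v_s$, $s\in\{1,\dots,t\}$ chosen at random (given the past) with probability $d_1^{t-1}(v_s)/(2t-1)$ for $s<t$ and $1/(2t-1)$ for $s=t$ (self-loop); degrees count self-loops twice. For $m\ge1$, $G_m^t$ is obtained from $G_1^{mt}$ (vertices $v'_1,\dots,v'_{mt}$) by merging, for each $i\le t$, the vertices $v'_{(i-1)m+1},\dots,v'_{im}$ into one vertex $v_i$, keeping all edges; the graphs $G_m^1,G_m^2,\dots$ form a single random process. The $r$-th edge of $v_u$ ($1\le r\le m$) is the edge created when $v'_{(u-1)m+r}$ was added in the $m=1$ process. $d_m^i(v)$ is the degree of $v$ in $G_m^i$; $\bar E$ denotes the complement of an event $E$. -}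

module Defs where

open import Data.Nat using (ℕ; zero; suc; _+_; _*_; _∸_; _^_; _<ᵇ_; _≤ᵇ_; _≡ᵇ_; _!)
open import Data.Bool.ListAction using (any)
open import Data.Bool using (Bool; true; false; _∧_; _∨_; if_then_else_)
open import Data.List using (List; []; _∷_; _++_; [_]; map; concatMap; length; foldr; upTo; take; filter)
open import Data.Product using (_×_; _,_; proj₁; proj₂)
open import Data.Integer using (+_)
open import Data.Rational using (ℚ; _/_; 0ℚ; 1ℚ) renaming (_+_ to _+ℚ_; _*_ to _*ℚ_)

frac : ℕ → ℕ → ℚ
frac n d = + n / suc d

-- 1/d as a rational (junk value 0 for d = 0; only used with d ≥ 1)
recip : ℕ → ℚ
recip zero = 0ℚ
recip (suc d) = + 1 / suc d

sumℚ : List ℚ → ℚ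
sumℚ = foldr _+ℚ_ 0ℚ

sumℕ1 : ℕ → (ℕ → ℕ) → ℕ
sumℕ1 zero f = 0
sumℕ1 (suc n) f = sumℕ1 n f + f (suc n)

count : ℕ → List ℕ → ℕ
count s [] = 0
count s (x ∷ xs) = (if x ≡ᵇ s then 1 else 0) + count s xs

-- A history of the m = 1 process of length t is the list [s_1, …, s_t]
-- where s_u ∈ {1,…,u} is the vertex chosen by the edge of v'_u.
-- (s_u = u means a self-loop.)

-- degree of v'_s in G_1^{t} where t = length h (self loops counted twice):
-- 1 for its own edge (if v'_s exists) + number of edges pointing at v'_s.
deg1 : List ℕ → ℕ → ℕ
deg1 h s = (if (1 ≤ᵇ s) ∧ (s ≤ᵇ length h) then 1 else 0) + count s h

-- probability that, given history h (of length t-1), the vertex v'_t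
-- chooses v'_s; here 2t-1 = suc (2 * length h).
stepProb : List ℕ → ℕ → ℚ
stepProb h s =
  if s ≡ᵇ suc (length h) then frac 1 (2 * length h)
  else frac (deg1 h s) (2 * length h)

from1 : ℕ → List ℕ
from1 n = map suc (upTo n)

hist : ℕ → List (List ℕ × ℚ)
hist zero = ([] , 1ℚ) ∷ []
hist (suc n) =
  concatMap (λ hw → map (λ s → (proj₁ hw ++ [ s ]) , (proj₂ hw *ℚ stepProb (proj₁ hw) s))
                        (from1 (suc n)))
            (hist n)

Pr : ℕ → (List ℕ → Bool) → ℚ
Pr n E = sumℚ (map proj₂ (filter (λ hw → E (proj₁ hw) Data.Bool.≟ true) (hist n)))
  where import Data.Bool

-- entry at (1-based) position u of a history (0 if absent)
at : List ℕ → ℕ → ℕ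
at [] u = 0
at (x ∷ xs) zero = 0
at (x ∷ xs) (suc zero) = x
at (x ∷ xs) (suc (suc u)) = at xs (suc u)

-- v'_x is merged into v_a (for m-merging): (a-1)m < x ≤ a m
inGroup : ℕ → ℕ → ℕ → Bool
inGroup m a x = ((a ∸ 1) * m <ᵇ x) ∧ (x ≤ᵇ a * m)

-- degree d_m^i(v_a) of v_a in G_m^i (computed from a history of length ≥ m i)
degm : ℕ → ℕ → List ℕ → ℕ → ℕ
degm m i h a = sumℕ1 m (λ r → deg1 (take (m * i) h) ((a ∸ 1) * m + r))

-- the r-th edge of v_u (from v_u to the vertex containing v'_s, s its
-- chosen endpoint) is incident to v_a
edgeIncident : ℕ → List ℕ → ℕ → ℕ → ℕ → Bool
edgeIncident m h u r a = (u ≡ᵇ a) ∨ inGroup m a (at h ((u ∸ 1) * m + r))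

-- event B_i : d_m^i(v_a) ≥ m √i /(4k) and d_m^i(v_b) ≥ m √i /(4k),
-- written equivalently (all quantities nonnegative) as (4k d)^2 ≥ m^2 i
Bev : ℕ → ℕ → ℕ → ℕ → ℕ → List ℕ → Bool
Bev m k a b i h =
  (m * m * i ≤ᵇ (4 * k * degm m i h a) * (4 * k * degm m i h a)) ∧
  (m * m * i ≤ᵇ (4 * k * degm m i h b) * (4 * k * degm m i h b))

-- event A_{j,i}: some v_u, max(j,1) ≤ u ≤ i, has its first edge incident
-- to v_a and its second edge incident to v_b
Aev : ℕ → ℕ → ℕ → ℕ → ℕ → List ℕ → Bool
Aev m a b j i h =
  any (λ u → (1 ≤ᵇ u) ∧ (j ≤ᵇ u) ∧ edgeIncident m h u 1 a ∧ edgeIncident m h u 2 b)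
      (upTo (suc i))

-- Taylor partial sum Σ_{l=0}^{n} x^l / l!  with x = 1/(256 k^2)
expPartial : ℕ → ℕ → ℚ
expPartial k zero = 1ℚ
expPartial k (suc n) = expPartial k n +ℚ recip ((256 * k * k) ^ suc n * (suc n) !)

module Submission where

-- Lemma 15: with C = Ā_{j,i} ∩ B_i and F_u = Ā_{i+1,u} ∩ C, the statement below reads
-- Pr(F_{2i}) · T_n ≤ Pr(C), where T_n = Σ_{l≤n} x^l/l! ≤ e^x and x = 1/(256k²); that is,
-- Pr(Ā_{i+1,2i} | C) ≤ e^{-x}, stated without reals or division.
--
-- Let q = 1/(256k²i) and i ≤ u < 2i.  On F_u the event F_{u+1} fails as soon as the
-- first edge of v_{u+1} lands on v_a (probability d(v_a)/(2L+1), L = mu) and its second on v_b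
-- (probability ≥ d(v_b)/(2L+3)).  On B_i these degrees are ≥ m√i/(4k) and they never decrease,
-- while 2L+3 ≤ 4mi, so both happen with probability ≥ q: Pr(F_{u+1}) ≤ (1-q) Pr(F_u).  Iterating
-- from F_i = C gives Pr(F_{2i}) ≤ (1-q)^i Pr(C), and (1-q)^i T_n ≤ 1 by an elementary induction.

module Development where

  open import Data.Nat as ℕ using (ℕ; zero; suc; z≤n; s≤s; _∸_; _!; _≡ᵇ_; _≤ᵇ_; _<ᵇ_)
    renaming (_≤_ to _≤ₙ_; _<_ to _<ₙ_; _+_ to _+ₙ_; _*_ to _*ₙ_; _^_ to _^ₙ_)
  import Data.Nat.Properties as ℕP
  open import Data.Nat.Tactic.RingSolver using (solve-∀)
  import Data.Integer as ℤ
  import Data.Integer.Properties as ℤP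
  open import Data.Rational hiding (truncate; _≤ᵇ_)
  open import Data.Rational.Properties
  import Data.Rational.Unnormalised as U
  import Data.Rational.Unnormalised.Properties as UP
  open import Data.Rational.Solver
  open +-*-Solver
  open import Data.Bool using (Bool; true; false; T; if_then_else_; _∧_; _∨_; not)
  import Data.Bool
  import Data.Bool.Properties as BP
  open import Data.Bool.ListAction using (any)
  open import Data.List using (List; []; _∷_; _++_; [_]; map; concatMap; length; upTo; filter; take)
  import Data.List.Properties as LP
  open import Data.List.Relation.Unary.All as All using (All; []; _∷_)
  import Data.List.Relation.Unary.All.Properties as AP
  open import Data.Product using (_×_; _,_; proj₁; proj₂)
  open import Data.Unit using (⊤; tt)
  open import Data.Empty using (⊥-elim)
  open import Function.Bundles using (Equivalence)
  open import Data.Sum using (inj₁; inj₂)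
  open import Relation.Nullary using (yes; no)
  open import Relation.Binary.PropositionalEquality hiding ([_])
  open import Defs

  T→≡ : ∀ {b} → T b → b ≡ true
  T→≡ {true} _ = refl

  ≡→T : ∀ {b} → b ≡ true → T b
  ≡→T refl = tt

  ∧-true-right : ∀ x y → x ∧ y ≡ true → y ≡ true
  ∧-true-right true y e = e

  ≡ᵇ-refl : ∀ n → (n ≡ᵇ n) ≡ true
  ≡ᵇ-refl n = T→≡ (ℕP.≡⇒≡ᵇ n n refl)

  ≡ᵇ-false : ∀ m n → m ≢ n → (m ≡ᵇ n) ≡ false
  ≡ᵇ-false m n ne with m ≡ᵇ n in eq
  ... | true = ⊥-elim (ne (ℕP.≡ᵇ⇒≡ m n (≡→T eq)))
  ... | false = refl

  ≤ᵇ-true : ∀ {m n} → m ≤ₙ n → (m ≤ᵇ n) ≡ true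
  ≤ᵇ-true p = T→≡ (ℕP.≤⇒≤ᵇ p)

  ≤ᵇ-false : ∀ {m n} → n <ₙ m → (m ≤ᵇ n) ≡ false
  ≤ᵇ-false {m} {n} lt with m ≤ᵇ n in eq
  ... | true = ⊥-elim (ℕP.<⇒≱ lt (ℕP.≤ᵇ⇒≤ m n (≡→T eq)))
  ... | false = refl

  <ᵇ-true : ∀ {m n} → m <ₙ n → (m <ᵇ n) ≡ true
  <ᵇ-true p = T→≡ (ℕP.<⇒<ᵇ p)

  <ᵇ-false : ∀ {m n} → n ≤ₙ m → (m <ᵇ n) ≡ false
  <ᵇ-false {m} {n} le with m <ᵇ n in eq
  ... | true = ⊥-elim (ℕP.<⇒≱ (ℕP.<ᵇ⇒< m n (≡→T eq)) le)
  ... | false = refl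

  module Fractions where

    open ℤ using (+_)

    ι : ℕ → ℚ
    ι n = frac n 0

    frac-ᵘ : ∀ n d → toℚᵘ (frac n d) U.≃ U.mkℚᵘ (+ n) d
    frac-ᵘ n d = toℚᵘ-fromℚᵘ (U.mkℚᵘ (+ n) d)

    ι-+ : ∀ a b → ι (a +ₙ b) ≡ ι a + ι b
    ι-+ a b = toℚᵘ-injective (UP.≃-trans (frac-ᵘ (a +ₙ b) 0) (UP.≃-trans (UP.≃-sym sumᵘ)
      (UP.≃-sym (UP.≃-trans (toℚᵘ-homo-+ (ι a) (ι b)) (UP.+-cong (frac-ᵘ a 0) (frac-ᵘ b 0))))))
      where
      sumᵘ : (U.mkℚᵘ (+ a) 0 U.+ U.mkℚᵘ (+ b) 0) U.≃ U.mkℚᵘ (+ (a +ₙ b)) 0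
      sumᵘ = U.*≡* (cong (ℤ._* + 1) (trans (cong₂ ℤ._+_ (ℤP.*-identityʳ (+ a)) (ℤP.*-identityʳ (+ b))) (sym (ℤP.pos-+ a b))))

    ι-* : ∀ a b → ι (a *ₙ b) ≡ ι a * ι b
    ι-* a b = toℚᵘ-injective (UP.≃-trans (frac-ᵘ (a *ₙ b) 0) (UP.≃-trans (UP.≃-sym productᵘ)
      (UP.≃-sym (UP.≃-trans (toℚᵘ-homo-* (ι a) (ι b)) (UP.*-cong (frac-ᵘ a 0) (frac-ᵘ b 0))))))
      where
      productᵘ : (U.mkℚᵘ (+ a) 0 U.* U.mkℚᵘ (+ b) 0) U.≃ U.mkℚᵘ (+ (a *ₙ b)) 0
      productᵘ = U.*≡* (cong (ℤ._* + 1) (sym (ℤP.pos-* a b)))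

    ι-suc : ∀ n → ι (suc n) ≡ 1ℚ + ι n
    ι-suc n = ι-+ 1 n

    frac-split : ∀ n d → frac n d ≡ ι n * frac 1 d
    frac-split n d = toℚᵘ-injective (UP.≃-trans (frac-ᵘ n d)
      (UP.≃-sym (UP.≃-trans (toℚᵘ-homo-* (ι n) (frac 1 d)) (UP.≃-trans (UP.*-cong (frac-ᵘ n 0) (frac-ᵘ 1 d)) splitᵘ))))
      where
      splitᵘ : (U.mkℚᵘ (+ n) 0 U.* U.mkℚᵘ (+ 1) d) U.≃ U.mkℚᵘ (+ n) d
      splitᵘ = U.*≡* (trans (cong (ℤ._* + suc d) (ℤP.*-identityʳ (+ n))) (cong (+ n ℤ.*_) (cong +_ (sym (ℕP.*-identityˡ (suc d))))))

    frac-inv : ∀ d → frac 1 d * ι (suc d) ≡ 1ℚ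
    frac-inv d = toℚᵘ-injective (UP.≃-trans (toℚᵘ-homo-* (frac 1 d) (ι (suc d)))
      (UP.≃-trans (UP.*-cong (frac-ᵘ 1 d) (frac-ᵘ (suc d) 0)) invᵘ))
      where
      invᵘ : (U.mkℚᵘ (+ 1) d U.* U.mkℚᵘ (+ suc d) 0) U.≃ U.mkℚᵘ (+ 1) 0
      invᵘ = U.*≡* (trans (ℤP.*-identityʳ _) (trans (ℤP.*-identityˡ (+ suc d))
               (cong +_ (cong suc (sym (trans (ℕP.+-identityʳ (d ℕ.* 1)) (ℕP.*-identityʳ d)))))))

    frac-nonneg : ∀ n d → 0ℚ ≤ frac n d
    frac-nonneg n d = toℚᵘ-cancel-≤ (UP.≤-respʳ-≃ (UP.≃-sym (frac-ᵘ n d))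
      (U.*≤* (subst (+ 0 ℤ.≤_) (sym (ℤP.*-identityʳ (+ n))) (ℤ.+≤+ z≤n))))

    frac-≤ : ∀ a d b e → a *ₙ suc e ≤ₙ b *ₙ suc d → frac a d ≤ frac b e
    frac-≤ a d b e le = toℚᵘ-cancel-≤ (UP.≤-respʳ-≃ (UP.≃-sym (frac-ᵘ b e)) (UP.≤-respˡ-≃ (UP.≃-sym (frac-ᵘ a d))
      (U.*≤* (subst₂ ℤ._≤_ (ℤP.pos-* a (suc e)) (ℤP.pos-* b (suc d)) (ℤ.+≤+ le)))))

    frac-zero : ∀ d → frac 0 d ≡ 0ℚ
    frac-zero d = trans (frac-split 0 d) (*-zeroˡ (frac 1 d))

    frac-one : ∀ d → frac (suc d) d ≡ 1ℚ
    frac-one d = trans (frac-split (suc d) d) (trans (*-comm (ι (suc d)) (frac 1 d)) (frac-inv d))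

  open Fractions

  -- a rational r with r · n = 1 is uniquely determined; this identifies the various
  -- reciprocals produced by `recip`, `frac 1` and products of them
  inv-unique : ∀ r r' n → r * ι n ≡ 1ℚ → r' * ι n ≡ 1ℚ → r ≡ r'
  inv-unique r r' n e e' = begin
    r               ≡⟨ sym (*-identityʳ r) ⟩
    r * 1ℚ          ≡⟨ cong (r *_) (sym e') ⟩
    r * (r' * ι n)  ≡⟨ solve 3 (λ r r' x → r :* (r' :* x) := r' :* (r :* x)) refl r r' (ι n) ⟩
    r' * (r * ι n)  ≡⟨ cong (r' *_) e ⟩
    r' * 1ℚ         ≡⟨ *-identityʳ r' ⟩
    r'              ∎
    where open ≡-Reasoning

  inv-* : ∀ r r' a b → r * ι a ≡ 1ℚ → r' * ι b ≡ 1ℚ → (r * r') * ι (a *ₙ b) ≡ 1ℚ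
  inv-* r r' a b e e' = trans (cong ((r * r') *_) (ι-* a b))
    (trans (solve 4 (λ r r' x y → (r :* r') :* (x :* y) := (r :* x) :* (r' :* y)) refl r r' (ι a) (ι b))
    (trans (cong₂ _*_ e e') (*-identityˡ 1ℚ)))

  recip-inv : ∀ a → 1 ≤ₙ a → recip a * ι a ≡ 1ℚ
  recip-inv (suc d) _ = frac-inv d

  recip-frac : ∀ n → 1 ≤ₙ n → recip n ≡ frac 1 (n ∸ 1)
  recip-frac (suc n) _ = refl

  recip-nonneg : ∀ a → 0ℚ ≤ recip a
  recip-nonneg zero = ≤-refl
  recip-nonneg (suc d) = frac-nonneg 1 d

  recip≤1 : ∀ a → 1 ≤ₙ a → recip a ≤ 1ℚ
  recip≤1 (suc d) _ = frac-≤ 1 d 1 0 (s≤s z≤n)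

  *-monoˡ-nonneg : ∀ {r p q} → 0ℚ ≤ r → p ≤ q → r * p ≤ r * q
  *-monoˡ-nonneg {r} r≥0 = *-monoˡ-≤-nonNeg r {{nonNegative r≥0}}

  *-monoʳ-nonneg : ∀ {r p q} → 0ℚ ≤ r → p ≤ q → p * r ≤ q * r
  *-monoʳ-nonneg {r} r≥0 = *-monoʳ-≤-nonNeg r {{nonNegative r≥0}}

  *-mono-nonneg : ∀ {a b c d} → 0ℚ ≤ b → 0ℚ ≤ c → a ≤ b → c ≤ d → a * c ≤ b * d
  *-mono-nonneg b0 c0 ab cd = ≤-trans (*-monoʳ-nonneg c0 ab) (*-monoˡ-nonneg b0 cd)

  nonneg-* : ∀ {p q} → 0ℚ ≤ p → 0ℚ ≤ q → 0ℚ ≤ p * q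
  nonneg-* {p} p0 q0 = ≤-trans (≤-reflexive (sym (*-zeroʳ p))) (*-monoˡ-nonneg p0 q0)

  one-minus-nonneg : ∀ q → q ≤ 1ℚ → 0ℚ ≤ 1ℚ - q
  one-minus-nonneg q q1 = subst (_≤ 1ℚ - q) (+-inverseʳ q) (+-monoˡ-≤ (- q) q1)

  sumℚ-++ : ∀ xs ys → sumℚ (xs ++ ys) ≡ sumℚ xs + sumℚ ys
  sumℚ-++ [] ys = sym (+-identityˡ _)
  sumℚ-++ (x ∷ xs) ys = trans (cong (x +_) (sumℚ-++ xs ys)) (sym (+-assoc x _ _))

  sum-scale : ∀ {A : Set} (w : ℚ) (φ : A → ℚ) l → sumℚ (map (λ s → w * φ s) l) ≡ w * sumℚ (map φ l)
  sum-scale w φ [] = sym (*-zeroʳ w)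
  sum-scale w φ (x ∷ l) = trans (cong (w * φ x +_) (sum-scale w φ l)) (sym (*-distribˡ-+ w (φ x) _))

  sum-+ : ∀ {A : Set} (φ ψ : A → ℚ) l → sumℚ (map (λ x → φ x + ψ x) l) ≡ sumℚ (map φ l) + sumℚ (map ψ l)
  sum-+ φ ψ [] = sym (+-identityˡ 0ℚ)
  sum-+ φ ψ (x ∷ l) = trans (cong (φ x + ψ x +_) (sum-+ φ ψ l))
    (solve 4 (λ a b c d → a :+ b :+ (c :+ d) := a :+ c :+ (b :+ d)) refl (φ x) (ψ x) (sumℚ (map φ l)) (sumℚ (map ψ l)))

  sum-cong : ∀ {A : Set} (P : A → Set) (φ ψ : A → ℚ) l → All P l →
             (∀ x → P x → φ x ≡ ψ x) → sumℚ (map φ l) ≡ sumℚ (map ψ l)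
  sum-cong P φ ψ [] _ _ = refl
  sum-cong P φ ψ (x ∷ l) (px ∷ pl) eq = cong₂ _+_ (eq x px) (sum-cong P φ ψ l pl eq)

  sum-mono : ∀ {A : Set} (P : A → Set) (φ ψ : A → ℚ) l → All P l →
             (∀ x → P x → φ x ≤ ψ x) → sumℚ (map φ l) ≤ sumℚ (map ψ l)
  sum-mono P φ ψ [] _ _ = ≤-refl
  sum-mono P φ ψ (x ∷ l) (px ∷ pl) le = +-mono-≤ (le x px) (sum-mono P φ ψ l pl le)

  sum-nonneg : ∀ {A : Set} (P : A → Set) (φ : A → ℚ) l → All P l → (∀ x → P x → 0ℚ ≤ φ x) → 0ℚ ≤ sumℚ (map φ l)
  sum-nonneg P φ [] _ _ = ≤-refl
  sum-nonneg P φ (x ∷ l) (px ∷ pl) nn = +-mono-≤ (nn x px) (sum-nonneg P φ l pl nn)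

  sum-concatMap : ∀ {A B : Set} (g : B → ℚ) (F : A → List B) l →
                  sumℚ (map g (concatMap F l)) ≡ sumℚ (map (λ x → sumℚ (map g (F x))) l)
  sum-concatMap g F [] = refl
  sum-concatMap g F (x ∷ l) = trans (cong sumℚ (LP.map-++ g (F x) (concatMap F l)))
    (trans (sumℚ-++ (map g (F x)) (map g (concatMap F l))) (cong (sumℚ (map g (F x)) +_) (sum-concatMap g F l)))

  sumℚ1 : ℕ → (ℕ → ℚ) → ℚ
  sumℚ1 zero φ = 0ℚ
  sumℚ1 (suc T) φ = sumℚ1 T φ + φ (suc T)

  sumℚ1-cong : ∀ T φ ψ → (∀ s → 1 ≤ₙ s → s ≤ₙ T → φ s ≡ ψ s) → sumℚ1 T φ ≡ sumℚ1 T ψ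
  sumℚ1-cong zero φ ψ eq = refl
  sumℚ1-cong (suc T) φ ψ eq = cong₂ _+_ (sumℚ1-cong T φ ψ (λ s p q → eq s p (ℕP.m≤n⇒m≤1+n q))) (eq (suc T) (s≤s z≤n) ℕP.≤-refl)

  sumℕ1-cong : ∀ T f g → (∀ s → 1 ≤ₙ s → s ≤ₙ T → f s ≡ g s) → sumℕ1 T f ≡ sumℕ1 T g
  sumℕ1-cong zero f g eq = refl
  sumℕ1-cong (suc T) f g eq = cong₂ _+ₙ_ (sumℕ1-cong T f g (λ s p q → eq s p (ℕP.m≤n⇒m≤1+n q))) (eq (suc T) (s≤s z≤n) ℕP.≤-refl)

  sumℕ1-mono : ∀ T f g → (∀ r → f r ≤ₙ g r) → sumℕ1 T f ≤ₙ sumℕ1 T g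
  sumℕ1-mono zero f g le = z≤n
  sumℕ1-mono (suc T) f g le = ℕP.+-mono-≤ (sumℕ1-mono T f g le) (le (suc T))

  sumℕ1-+ : ∀ T f g → sumℕ1 T (λ s → f s +ₙ g s) ≡ sumℕ1 T f +ₙ sumℕ1 T g
  sumℕ1-+ zero f g = refl
  sumℕ1-+ (suc T) f g = trans (cong (_+ₙ (f (suc T) +ₙ g (suc T))) (sumℕ1-+ T f g))
    (interchange (sumℕ1 T f) (sumℕ1 T g) (f (suc T)) (g (suc T)))
    where
    interchange : ∀ a b c d → (a +ₙ b) +ₙ (c +ₙ d) ≡ (a +ₙ c) +ₙ (b +ₙ d)
    interchange = solve-∀

  sumℕ1-zero : ∀ T → sumℕ1 T (λ _ → 0) ≡ 0
  sumℕ1-zero zero = refl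
  sumℕ1-zero (suc T) = trans (ℕP.+-identityʳ _) (sumℕ1-zero T)

  sumℕ1-one : ∀ T → sumℕ1 T (λ _ → 1) ≡ T
  sumℕ1-one zero = refl
  sumℕ1-one (suc T) = trans (cong (_+ₙ 1) (sumℕ1-one T)) (ℕP.+-comm T 1)

  sumℚ1-frac : ∀ T g d → sumℚ1 T (λ s → frac (g s) d) ≡ frac (sumℕ1 T g) d
  sumℚ1-frac zero g d = trans (sym (*-zeroˡ (frac 1 d))) (sym (frac-split 0 d))
  sumℚ1-frac (suc T) g d = begin
    sumℚ1 T (λ s → frac (g s) d) + frac (g (suc T)) d
      ≡⟨ cong₂ _+_ (trans (sumℚ1-frac T g d) (frac-split (sumℕ1 T g) d)) (frac-split (g (suc T)) d) ⟩
    ι (sumℕ1 T g) * frac 1 d + ι (g (suc T)) * frac 1 d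
      ≡⟨ sym (*-distribʳ-+ (frac 1 d) (ι (sumℕ1 T g)) (ι (g (suc T)))) ⟩
    (ι (sumℕ1 T g) + ι (g (suc T))) * frac 1 d
      ≡⟨ cong (_* frac 1 d) (sym (ι-+ (sumℕ1 T g) (g (suc T)))) ⟩
    ι (sumℕ1 T g +ₙ g (suc T)) * frac 1 d
      ≡⟨ sym (frac-split (sumℕ1 T g +ₙ g (suc T)) d) ⟩
    frac (sumℕ1 T g +ₙ g (suc T)) d ∎
    where open ≡-Reasoning

  from1-suc : ∀ T → from1 (suc T) ≡ from1 T ++ [ suc T ]
  from1-suc T = trans (cong (map suc) (sym (LP.upTo-∷ʳ T))) (LP.map-++ suc (upTo T) [ T ])

  sum-from1 : ∀ T φ → sumℚ (map φ (from1 T)) ≡ sumℚ1 T φ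
  sum-from1 zero φ = refl
  sum-from1 (suc T) φ = trans (cong (λ l → sumℚ (map φ l)) (from1-suc T))
    (trans (cong sumℚ (LP.map-++ φ (from1 T) [ suc T ]))
    (trans (sumℚ-++ (map φ (from1 T)) [ φ (suc T) ])
     (cong₂ _+_ (sum-from1 T φ) (+-identityʳ (φ (suc T))))))

  all-upTo : ∀ n → All (_<ₙ n) (upTo n)
  all-upTo zero = []
  all-upTo (suc n) = subst (All (_<ₙ suc n)) (LP.upTo-∷ʳ n)
    (AP.++⁺ (All.map ℕP.m<n⇒m<1+n (all-upTo n)) (ℕP.n<1+n n ∷ []))

  all-from1 : ∀ n → All (λ x → 1 ≤ₙ x × x ≤ₙ n) (from1 n)
  all-from1 n = AP.map⁺ (All.map (λ x<n → s≤s z≤n , x<n) (all-upTo n))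

  -- Histories.  `Valid n h` says that h = [s_1,…,s_n] is a history that the m = 1 process can
  -- produce: it has length n, every s_u lies in 1..n, and s_u ≤ u (every prefix of length p
  -- only mentions vertices v'_1..v'_p).

  Prefix-bounded : List ℕ → Set
  Prefix-bounded h = ∀ p → All (_≤ₙ p) (take p h)

  Valid : ℕ → List ℕ → Set
  Valid n h = (length h ≡ n × All (λ x → 1 ≤ₙ x × x ≤ₙ n) h) × Prefix-bounded h

  take-++-≤ : ∀ p (h xs : List ℕ) → p ≤ₙ length h → take p (h ++ xs) ≡ take p h
  take-++-≤ zero h xs _ = refl
  take-++-≤ (suc p) (x ∷ h) xs (s≤s le) = cong (x ∷_) (take-++-≤ p h xs le)

  length-snoc : ∀ (h : List ℕ) s → length (h ++ [ s ]) ≡ suc (length h)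
  length-snoc h s = trans (LP.length-++ h) (ℕP.+-comm (length h) 1)

  Prefix-bounded-snoc : ∀ h s → Prefix-bounded h → s ≤ₙ suc (length h) → Prefix-bounded (h ++ [ s ])
  Prefix-bounded-snoc h s pos s≤ p with p ℕ.≤? length h
  ... | yes le = subst (All (_≤ₙ p)) (sym (take-++-≤ p h [ s ] le)) (pos p)
  ... | no nle = subst (All (_≤ₙ p)) (sym (LP.take-all p (h ++ [ s ]) (subst (_≤ₙ p) (sym (length-snoc h s)) lt)))
          (AP.++⁺ (All.map (λ x≤ → ℕP.≤-trans x≤ (ℕP.<⇒≤ lt)) whole) (ℕP.≤-trans s≤ lt ∷ []))
    where
    lt : length h <ₙ p
    lt = ℕP.≰⇒> nle
    whole : All (_≤ₙ length h) h
    whole = subst (All (_≤ₙ length h)) (LP.take-all (length h) h ℕP.≤-refl) (pos (length h))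

  Valid-snoc : ∀ n h s → Valid n h → 1 ≤ₙ s → s ≤ₙ suc n → Valid (suc n) (h ++ [ s ])
  Valid-snoc n h s ((len , range) , pos) p q =
    (trans (length-snoc h s) (cong suc len) , AP.++⁺ (All.map (λ (a , b) → a , ℕP.m≤n⇒m≤1+n b) range) ((p , q) ∷ [])) ,
    Prefix-bounded-snoc h s pos (subst (λ z → s ≤ₙ suc z) (sym len) q)

  stepProb-nonneg : ∀ h s → 0ℚ ≤ stepProb h s
  stepProb-nonneg h s with s ≡ᵇ suc (length h)
  ... | true = frac-nonneg 1 (2 *ₙ length h)
  ... | false = frac-nonneg (deg1 h s) (2 *ₙ length h)

  Weighted : ℕ → List ℕ × ℚ → Set
  Weighted n hw = Valid n (proj₁ hw) × 0ℚ ≤ proj₂ hw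

  hist-weighted : ∀ n → All (Weighted n) (hist n)
  hist-weighted zero = (((refl , []) , λ { zero → [] ; (suc p) → [] }) , frac-nonneg 1 0) ∷ []
  hist-weighted (suc n) = AP.concat⁺ (AP.map⁺ (All.map extend (hist-weighted n)))
    where
    extend : ∀ {hw} → Weighted n hw →
      All (Weighted (suc n)) (map (λ s → (proj₁ hw ++ [ s ]) , (proj₂ hw * stepProb (proj₁ hw) s)) (from1 (suc n)))
    extend {h , w} (v , w0) =
      AP.map⁺ (All.map (λ {s} (p , q) → Valid-snoc n h s v p q , nonneg-* w0 (stepProb-nonneg h s)) (all-from1 (suc n)))

  -- The expectation E_n f of a function of the history at time n, and the one-step kernel
  -- K_n h f = Σ_s Pr(s_{n+1} = s | h) f(h s).  E-step is the tower property.

  E : ℕ → (List ℕ → ℚ) → ℚ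
  E n f = sumℚ (map (λ hw → proj₂ hw * f (proj₁ hw)) (hist n))

  K : ℕ → List ℕ → (List ℕ → ℚ) → ℚ
  K n h f = sumℚ (map (λ s → stepProb h s * f (h ++ [ s ])) (from1 (suc n)))

  E-step : ∀ n f → E (suc n) f ≡ E n (λ h → K n h f)
  E-step n f = trans (sum-concatMap (λ hw → proj₂ hw * f (proj₁ hw)) children (hist n))
    (sum-cong (λ _ → ⊤) _ _ (hist n) (All.universal (λ _ → tt) (hist n)) (λ hw _ → child-sum hw))
    where
    children : List ℕ × ℚ → List (List ℕ × ℚ)
    children (h , w) = map (λ s → (h ++ [ s ]) , (w * stepProb h s)) (from1 (suc n))
    child-sum : ∀ hw → sumℚ (map (λ hw → proj₂ hw * f (proj₁ hw)) (children hw)) ≡ proj₂ hw * K n (proj₁ hw) f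
    child-sum (h , w) = trans (cong sumℚ (sym (LP.map-∘ {g = λ hw → proj₂ hw * f (proj₁ hw)} {f = λ s → (h ++ [ s ]) , (w * stepProb h s)} (from1 (suc n)))))
      (trans (sum-cong (λ _ → ⊤) (λ s → w * stepProb h s * f (h ++ [ s ])) (λ s → w * (stepProb h s * f (h ++ [ s ]))) (from1 (suc n)) (All.universal (λ _ → tt) _)
                (λ s _ → *-assoc w (stepProb h s) (f (h ++ [ s ]))))
             (sum-scale w (λ s → stepProb h s * f (h ++ [ s ])) (from1 (suc n))))

  E-mono : ∀ n f g → (∀ h → Valid n h → f h ≤ g h) → E n f ≤ E n g
  E-mono n f g le = sum-mono (Weighted n) _ _ (hist n) (hist-weighted n) (λ (h , w) (v , w0) → *-monoˡ-nonneg w0 (le h v))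

  E-cong : ∀ n f g → (∀ h → Valid n h → f h ≡ g h) → E n f ≡ E n g
  E-cong n f g eq = sum-cong (Weighted n) _ _ (hist n) (hist-weighted n) (λ (h , w) (v , w0) → cong (w *_) (eq h v))

  E-scale : ∀ n c f → E n (λ h → c * f h) ≡ c * E n f
  E-scale n c f = trans (sum-cong (λ _ → ⊤) _ (λ hw → c * (proj₂ hw * f (proj₁ hw))) (hist n) (All.universal (λ _ → tt) _)
      (λ (h , w) _ → solve 3 (λ w c x → w :* (c :* x) := c :* (w :* x)) refl w c (f h)))
    (sum-scale c (λ hw → proj₂ hw * f (proj₁ hw)) (hist n))

  E-nonneg : ∀ n f → (∀ h → Valid n h → 0ℚ ≤ f h) → 0ℚ ≤ E n f
  E-nonneg n f nn = sum-nonneg (Weighted n) _ (hist n) (hist-weighted n) (λ (h , w) (v , w0) → nonneg-* w0 (nn h v))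

  ind : Bool → ℚ
  ind true = 1ℚ
  ind false = 0ℚ

  ind-not : ∀ x → ind (not x) ≡ 1ℚ + (- 1ℚ) * ind x
  ind-not true = refl
  ind-not false = refl

  Pr-E : ∀ n P → Pr n P ≡ E n (λ h → ind (P h))
  Pr-E n P = filtered-sum (hist n)
    where
    filtered-sum : ∀ l → sumℚ (map proj₂ (filter (λ hw → P (proj₁ hw) Data.Bool.≟ true) l))
                         ≡ sumℚ (map (λ hw → proj₂ hw * ind (P (proj₁ hw))) l)
    filtered-sum [] = refl
    filtered-sum ((h , w) ∷ l) with P h
    ... | true = cong₂ _+_ (sym (*-identityʳ w)) (filtered-sum l)
    ... | false = trans (filtered-sum l) (trans (sym (+-identityˡ _)) (cong (_+ _) (sym (*-zeroʳ w))))

  Pr-nonneg : ∀ n P → 0ℚ ≤ Pr n P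
  Pr-nonneg n P = subst (0ℚ ≤_) (sym (Pr-E n P)) (E-nonneg n _ (λ h _ → ind-nonneg (P h)))
    where
    ind-nonneg : ∀ b → 0ℚ ≤ ind b
    ind-nonneg true = frac-nonneg 1 0
    ind-nonneg false = ≤-refl

  K-mono : ∀ n h f g → (∀ s → 1 ≤ₙ s → s ≤ₙ suc n → f (h ++ [ s ]) ≤ g (h ++ [ s ])) → K n h f ≤ K n h g
  K-mono n h f g le = sum-mono (λ s → 1 ≤ₙ s × s ≤ₙ suc n) _ _ (from1 (suc n)) (all-from1 (suc n))
    (λ s (p , q) → *-monoˡ-nonneg (stepProb-nonneg h s) (le s p q))

  K-cong : ∀ n h f g → (∀ s → 1 ≤ₙ s → s ≤ₙ suc n → f (h ++ [ s ]) ≡ g (h ++ [ s ])) → K n h f ≡ K n h g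
  K-cong n h f g eq = sum-cong (λ s → 1 ≤ₙ s × s ≤ₙ suc n) _ _ (from1 (suc n)) (all-from1 (suc n))
    (λ s (p , q) → cong (stepProb h s *_) (eq s p q))

  -- The kernel is stochastic: the attachment weights of a valid history of length n are
  -- d(v'_s) for s ≤ n and 1 for the new vertex, and the degrees sum to 2n (every edge counts
  -- twice), so the weights sum to 2n+1.

  weight : List ℕ → ℕ → ℕ
  weight h s = if s ≡ᵇ suc (length h) then 1 else deg1 h s

  stepProb-weight : ∀ h s → stepProb h s ≡ frac (weight h s) (2 *ₙ length h)
  stepProb-weight h s with s ≡ᵇ suc (length h)
  ... | true = refl
  ... | false = refl

  indicator : ℕ → ℕ → ℕ
  indicator x s = if x ≡ᵇ s then 1 else 0

  sum-indicator-out : ∀ L x → L <ₙ x → sumℕ1 L (indicator x) ≡ 0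
  sum-indicator-out zero x _ = refl
  sum-indicator-out (suc L) x lt rewrite ≡ᵇ-false x (suc L) (λ e → ℕP.<-irrefl (sym e) lt) =
    trans (ℕP.+-identityʳ _) (sum-indicator-out L x (ℕP.<-trans (ℕP.n<1+n L) lt))

  sum-indicator-in : ∀ L x → 1 ≤ₙ x → x ≤ₙ L → sumℕ1 L (indicator x) ≡ 1
  sum-indicator-in zero x p q = ⊥-elim (ℕP.<-irrefl refl (ℕP.≤-trans p q))
  sum-indicator-in (suc L) x p q with ℕP.m≤n⇒m<n∨m≡n q
  ... | inj₁ lt rewrite ≡ᵇ-false x (suc L) (λ e → ℕP.<-irrefl e lt) =
    trans (ℕP.+-identityʳ _) (sum-indicator-in L x p (ℕP.≤-pred lt))
  ... | inj₂ refl rewrite ≡ᵇ-refl (suc L) = cong (_+ₙ 1) (sum-indicator-out L (suc L) (ℕP.n<1+n L))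

  sum-count : ∀ L h → All (λ x → 1 ≤ₙ x × x ≤ₙ L) h → sumℕ1 L (λ s → count s h) ≡ length h
  sum-count L [] _ = sumℕ1-zero L
  sum-count L (x ∷ h) ((p , q) ∷ range) = trans (sumℕ1-+ L (indicator x) (λ s → count s h))
    (cong₂ _+ₙ_ (sum-indicator-in L x p q) (sum-count L h range))

  deg1-born : ∀ n h s → length h ≡ n → 1 ≤ₙ s → s ≤ₙ n → deg1 h s ≡ suc (count s h)
  deg1-born n h s len p q rewrite ≤ᵇ-true p | ≤ᵇ-true (subst (s ≤ₙ_) (sym len) q) = refl

  sum-weight : ∀ n h → Valid n h → sumℕ1 (suc n) (weight h) ≡ suc (2 *ₙ n)
  sum-weight n h ((len , range) , _) =
    trans (cong₂ _+ₙ_ old new) (double n)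
    where
    double : ∀ n → (n +ₙ n) +ₙ 1 ≡ suc (2 *ₙ n)
    double = solve-∀
    old : sumℕ1 n (weight h) ≡ n +ₙ n
    old = trans (sumℕ1-cong n (weight h) (λ s → 1 +ₙ count s h) (λ s p q →
            trans (cong (λ b → if b then 1 else deg1 h s)
                        (≡ᵇ-false s (suc (length h)) (λ e → ℕP.<-irrefl e (s≤s (subst (s ≤ₙ_) (sym len) q)))))
                  (deg1-born n h s len p q)))
          (trans (sumℕ1-+ n (λ _ → 1) (λ s → count s h)) (cong₂ _+ₙ_ (sumℕ1-one n) (trans (sum-count n h range) len)))
    new : weight h (suc n) ≡ 1
    new rewrite len | ≡ᵇ-refl n = refl

  K-as-sum : ∀ n h f → length h ≡ n → K n h f ≡ sumℚ1 (suc n) (λ s → frac (weight h s) (2 *ₙ n) * f (h ++ [ s ]))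
  K-as-sum n h f len = trans (sum-from1 (suc n) _)
    (sumℚ1-cong (suc n) _ _ (λ s _ _ → cong (_* f (h ++ [ s ])) (trans (stepProb-weight h s) (cong (λ L → frac (weight h s) (2 *ₙ L)) len))))

  K-one : ∀ n h → Valid n h → K n h (λ _ → 1ℚ) ≡ 1ℚ
  K-one n h v@((len , _) , _) = begin
    K n h (λ _ → 1ℚ)                                     ≡⟨ K-as-sum n h (λ _ → 1ℚ) len ⟩
    sumℚ1 (suc n) (λ s → frac (weight h s) (2 *ₙ n) * 1ℚ)
      ≡⟨ sumℚ1-cong (suc n) _ _ (λ s _ _ → *-identityʳ _) ⟩
    sumℚ1 (suc n) (λ s → frac (weight h s) (2 *ₙ n))      ≡⟨ sumℚ1-frac (suc n) (weight h) (2 *ₙ n) ⟩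
    frac (sumℕ1 (suc n) (weight h)) (2 *ₙ n)              ≡⟨ cong (λ z → frac z (2 *ₙ n)) (sum-weight n h v) ⟩
    frac (suc (2 *ₙ n)) (2 *ₙ n)                          ≡⟨ frac-one (2 *ₙ n) ⟩
    1ℚ                                                    ∎
    where open ≡-Reasoning

  K-const : ∀ n h f c → Valid n h → (∀ s → 1 ≤ₙ s → s ≤ₙ suc n → f (h ++ [ s ]) ≡ c) → K n h f ≡ c
  K-const n h f c v eq = trans (K-cong n h f (λ h' → c * 1ℚ) (λ s p q → trans (eq s p q) (sym (*-identityʳ c))))
    (trans (sum-cong (λ _ → ⊤) _ (λ s → c * (stepProb h s * 1ℚ)) (from1 (suc n)) (All.universal (λ _ → tt) _)
              (λ s _ → solve 2 (λ a c → a :* (c :* con 1ℚ) := c :* (a :* con 1ℚ)) refl (stepProb h s) c))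
    (trans (sum-scale c (λ s → stepProb h s * 1ℚ) (from1 (suc n))) (trans (cong (c *_) (K-one n h v)) (*-identityʳ c))))

  K-affine : ∀ n h c d f → Valid n h → K n h (λ h' → c + d * f h') ≡ c + d * K n h f
  K-affine n h c d f v =
    trans (sum-cong (λ _ → ⊤) _ (λ s → c * (stepProb h s * 1ℚ) + d * (stepProb h s * f (h ++ [ s ]))) (from1 (suc n))
             (All.universal (λ _ → tt) _)
             (λ s _ → solve 4 (λ p c d x → p :* (c :+ d :* x) := c :* (p :* con 1ℚ) :+ d :* (p :* x)) refl (stepProb h s) c d (f (h ++ [ s ]))))
    (trans (sum-+ (λ s → c * (stepProb h s * 1ℚ)) (λ s → d * (stepProb h s * f (h ++ [ s ]))) (from1 (suc n)))
    (cong₂ _+_ (trans (sum-scale c (λ s → stepProb h s * 1ℚ) (from1 (suc n))) (trans (cong (c *_) (K-one n h v)) (*-identityʳ c)))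
               (sum-scale d (λ s → stepProb h s * f (h ++ [ s ])) (from1 (suc n)))))

  E-stable : ∀ ℓ d f → (∀ n h s → ℓ ≤ₙ n → Valid n h → 1 ≤ₙ s → s ≤ₙ suc n → f (h ++ [ s ]) ≡ f h) →
             E (ℓ +ₙ d) f ≡ E ℓ f
  E-stable ℓ zero f stable rewrite ℕP.+-identityʳ ℓ = refl
  E-stable ℓ (suc d) f stable rewrite ℕP.+-suc ℓ d =
    trans (E-step (ℓ +ₙ d) f)
    (trans (E-cong (ℓ +ₙ d) _ f (λ h v → K-const (ℓ +ₙ d) h f (f h) v (λ s p q → stable (ℓ +ₙ d) h s (ℕP.m≤m+n ℓ d) v p q)))
           (E-stable ℓ d f stable))

  -- With T_n(y) = Σ_{l ≤ n} y^l / l! (a lower bound for e^y) we show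
  -- (1-q)^t T_n(tq) ≤ 1 for 0 ≤ q ≤ 1, the discrete form of (1-q)^t ≤ e^{-tq}.  The step is
  -- (1-q) T_n(b+q) ≤ T_n(b), a consequence of the mean-value type estimate for powers
  -- (b+q)^{l+1} ≤ b^{l+1} + (l+1) q (b+q)^l.

  pow : ℚ → ℕ → ℚ
  pow y zero = 1ℚ
  pow y (suc l) = y * pow y l

  invFact : ℕ → ℚ
  invFact l = recip (l !)

  taylor : ℕ → ℚ → ℚ
  taylor zero y = 1ℚ
  taylor (suc n) y = taylor n y + pow y (suc n) * invFact (suc n)

  invFact-inv : ∀ l → invFact l * ι (l !) ≡ 1ℚ
  invFact-inv l = recip-inv (l !) (ℕP.1≤n! l)

  invFact-suc : ∀ l → invFact (suc l) * ι (suc l) ≡ invFact l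
  invFact-suc l = inv-unique _ _ (l !)
    (trans (solve 3 (λ a x y → (a :* x) :* y := a :* (x :* y)) refl (invFact (suc l)) (ι (suc l)) (ι (l !)))
           (trans (cong (invFact (suc l) *_) (sym (ι-* (suc l) (l !)))) (invFact-inv (suc l))))
    (invFact-inv l)

  invFact-nonneg : ∀ l → 0ℚ ≤ invFact l
  invFact-nonneg l = recip-nonneg (l !)

  pow-nonneg : ∀ {y} l → 0ℚ ≤ y → 0ℚ ≤ pow y l
  pow-nonneg zero y0 = frac-nonneg 1 0
  pow-nonneg (suc l) y0 = nonneg-* y0 (pow-nonneg l y0)

  pow-mono : ∀ {a b} l → 0ℚ ≤ b → b ≤ a → pow b l ≤ pow a l
  pow-mono zero b0 ba = ≤-refl
  pow-mono (suc l) b0 ba = *-mono-nonneg (≤-trans b0 ba) (pow-nonneg l b0) ba (pow-mono l b0 ba)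

  taylor-nonneg : ∀ n y → 0ℚ ≤ y → 0ℚ ≤ taylor n y
  taylor-nonneg zero y y0 = frac-nonneg 1 0
  taylor-nonneg (suc n) y y0 = +-mono-≤ (taylor-nonneg n y y0) (nonneg-* (pow-nonneg (suc n) y0) (invFact-nonneg (suc n)))

  pow-increment : ∀ b q l → 0ℚ ≤ b → 0ℚ ≤ q → pow (b + q) (suc l) ≤ pow b (suc l) + ι (suc l) * q * pow (b + q) l
  pow-increment b q zero b0 q0 =
    ≤-reflexive (solve 2 (λ b q → (b :+ q) :* con 1ℚ := b :* con 1ℚ :+ con 1ℚ :* q :* con 1ℚ) refl b q)
  pow-increment b q (suc l) b0 q0 = begin
    (b + q) * pow a (suc l)
      ≤⟨ *-monoˡ-nonneg a0 (pow-increment b q l b0 q0) ⟩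
    (b + q) * (pow b (suc l) + ι (suc l) * q * pow a l)
      ≡⟨ solve 5 (λ b q P L A → (b :+ q) :* (P :+ L :* q :* A) := b :* P :+ q :* P :+ L :* q :* ((b :+ q) :* A)) refl
           b q (pow b (suc l)) (ι (suc l)) (pow a l) ⟩
    b * pow b (suc l) + q * pow b (suc l) + ι (suc l) * q * pow a (suc l)
      ≤⟨ +-monoˡ-≤ (ι (suc l) * q * pow a (suc l)) (+-monoʳ-≤ (b * pow b (suc l)) (*-monoˡ-nonneg q0 (pow-mono (suc l) b0 b≤a))) ⟩
    b * pow b (suc l) + q * pow a (suc l) + ι (suc l) * q * pow a (suc l)
      ≡⟨ solve 4 (λ B q A L → B :+ q :* A :+ L :* q :* A := B :+ (con 1ℚ :+ L) :* q :* A) refl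
           (b * pow b (suc l)) q (pow a (suc l)) (ι (suc l)) ⟩
    b * pow b (suc l) + (1ℚ + ι (suc l)) * q * pow a (suc l)
      ≡⟨ cong (λ z → b * pow b (suc l) + z * q * pow a (suc l)) (sym (ι-suc (suc l))) ⟩
    b * pow b (suc l) + ι (suc (suc l)) * q * pow a (suc l) ∎
    where
    open ≤-Reasoning
    a : ℚ
    a = b + q
    a0 : 0ℚ ≤ a
    a0 = +-mono-≤ b0 q0
    b≤a : b ≤ a
    b≤a = subst (_≤ a) (+-identityʳ b) (+-monoʳ-≤ b q0)

  -- termwise the increment of y^l/l! is at most q times the previous term
  taylor-increment : ∀ b q n → 0ℚ ≤ b → 0ℚ ≤ q → taylor (suc n) (b + q) ≤ taylor (suc n) b + q * taylor n (b + q)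
  taylor-increment b q zero b0 q0 =
    ≤-reflexive (solve 2 (λ b q → con 1ℚ :+ (b :+ q) :* con 1ℚ :* con 1ℚ := (con 1ℚ :+ b :* con 1ℚ :* con 1ℚ) :+ q :* con 1ℚ) refl b q)
  taylor-increment b q (suc n) b0 q0 = begin
    taylor (suc n) a + pow a (suc (suc n)) * invFact (suc (suc n))
      ≤⟨ +-mono-≤ (taylor-increment b q n b0 q0) (*-monoʳ-nonneg (invFact-nonneg (suc (suc n))) (pow-increment b q (suc n) b0 q0)) ⟩
    (taylor (suc n) b + q * taylor n a) + (pow b (suc (suc n)) + ι (suc (suc n)) * q * pow a (suc n)) * invFact (suc (suc n))
      ≡⟨ solve 7 (λ TB TA PB L Q PA C → (TB :+ Q :* TA) :+ (PB :+ L :* Q :* PA) :* C := (TB :+ PB :* C) :+ Q :* (TA :+ PA :* (C :* L))) refl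
           (taylor (suc n) b) (taylor n a) (pow b (suc (suc n))) (ι (suc (suc n))) q (pow a (suc n)) (invFact (suc (suc n))) ⟩
    (taylor (suc n) b + pow b (suc (suc n)) * invFact (suc (suc n))) + q * (taylor n a + pow a (suc n) * (invFact (suc (suc n)) * ι (suc (suc n))))
      ≡⟨ cong (λ z → taylor (suc (suc n)) b + q * (taylor n a + pow a (suc n) * z)) (invFact-suc (suc n)) ⟩
    taylor (suc (suc n)) b + q * taylor (suc n) a ∎
    where
    open ≤-Reasoning
    a : ℚ
    a = b + q

  taylor-≤-suc : ∀ n y → 0ℚ ≤ y → taylor n y ≤ taylor (suc n) y
  taylor-≤-suc n y y0 = subst (_≤ taylor (suc n) y) (+-identityʳ (taylor n y))
    (+-monoʳ-≤ (taylor n y) (nonneg-* (pow-nonneg (suc n) y0) (invFact-nonneg (suc n))))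

  taylor-step : ∀ b q n → 0ℚ ≤ b → 0ℚ ≤ q → (1ℚ - q) * taylor n (b + q) ≤ taylor n b
  taylor-step b q n b0 q0 = begin
    (1ℚ - q) * A                 ≡⟨ solve 2 (λ q A → (con 1ℚ :- q) :* A := A :+ (:- (q :* A))) refl q A ⟩
    A + - (q * A)                ≤⟨ +-monoˡ-≤ (- (q * A)) (increment n) ⟩
    taylor n b + q * A + - (q * A) ≡⟨ solve 3 (λ B q A → B :+ q :* A :+ (:- (q :* A)) := B) refl (taylor n b) q A ⟩
    taylor n b                   ∎
    where
    open ≤-Reasoning
    A : ℚ
    A = taylor n (b + q)
    increment : ∀ n → taylor n (b + q) ≤ taylor n b + q * taylor n (b + q)
    increment zero = subst (_≤ 1ℚ + q * 1ℚ) (+-identityʳ 1ℚ) (+-monoʳ-≤ 1ℚ (nonneg-* q0 (frac-nonneg 1 0)))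
    increment (suc n) = ≤-trans (taylor-increment b q n b0 q0)
      (+-monoʳ-≤ (taylor (suc n) b) (*-monoˡ-nonneg q0 (taylor-≤-suc n (b + q) (+-mono-≤ b0 q0))))

  taylor-zero : ∀ n → taylor n 0ℚ ≡ 1ℚ
  taylor-zero zero = refl
  taylor-zero (suc n) = trans (cong₂ _+_ (taylor-zero n) (trans (cong (_* invFact (suc n)) (*-zeroˡ (pow 0ℚ n))) (*-zeroˡ (invFact (suc n)))))
    (+-identityʳ 1ℚ)

  decay-vs-taylor : ∀ n q t → 0ℚ ≤ q → q ≤ 1ℚ → pow (1ℚ - q) t * taylor n (ι t * q) ≤ 1ℚ
  decay-vs-taylor n q zero q0 q1 = ≤-reflexive (trans (*-identityˡ _) (trans (cong (taylor n) (*-zeroˡ q)) (taylor-zero n)))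
  decay-vs-taylor n q (suc t) q0 q1 = begin
    (1ℚ - q) * pow (1ℚ - q) t * taylor n (ι (suc t) * q)
      ≡⟨ cong (λ z → (1ℚ - q) * pow (1ℚ - q) t * taylor n z)
           (trans (cong (_* q) (ι-suc t)) (solve 2 (λ i q → (con 1ℚ :+ i) :* q := i :* q :+ q) refl (ι t) q)) ⟩
    (1ℚ - q) * pow (1ℚ - q) t * taylor n (ι t * q + q)
      ≡⟨ solve 3 (λ a b c → a :* b :* c := b :* (a :* c)) refl (1ℚ - q) (pow (1ℚ - q) t) (taylor n (ι t * q + q)) ⟩
    pow (1ℚ - q) t * ((1ℚ - q) * taylor n (ι t * q + q))
      ≤⟨ *-monoˡ-nonneg (pow-nonneg t (one-minus-nonneg q q1)) (taylor-step (ι t * q) q n (nonneg-* (frac-nonneg t 0) q0) q0) ⟩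
    pow (1ℚ - q) t * taylor n (ι t * q)
      ≤⟨ decay-vs-taylor n q t q0 q1 ⟩
    1ℚ ∎
    where open ≤-Reasoning

  recip-pow : ∀ X l → 1 ≤ₙ X → pow (recip X) l * ι (X ^ₙ l) ≡ 1ℚ
  recip-pow X zero _ = *-identityˡ 1ℚ
  recip-pow X (suc l) p = inv-* (recip X) (pow (recip X) l) X (X ^ₙ l) (recip-inv X p) (recip-pow X l p)

  taylor-term : ∀ X l → 1 ≤ₙ X → recip (X ^ₙ l *ₙ l !) ≡ pow (recip X) l * invFact l
  taylor-term X l p = inv-unique _ _ (X ^ₙ l *ₙ l !)
    (recip-inv _ (ℕP.*-mono-≤ (ℕP.m^n>0 X {{ℕ.>-nonZero p}} l) (ℕP.1≤n! l)))
    (inv-* (pow (recip X) l) (invFact l) (X ^ₙ l) (l !) (recip-pow X l p) (invFact-inv l))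

  256k²-pos : ∀ k → 1 ≤ₙ k → 1 ≤ₙ 256 *ₙ k *ₙ k
  256k²-pos k k1 = ℕP.*-mono-≤ {1} {256 *ₙ k} {1} {k} (ℕP.≤-trans k1 (ℕP.m≤n*m k 256)) k1

  expPartial-taylor : ∀ k n → 1 ≤ₙ k → expPartial k n ≡ taylor n (recip (256 *ₙ k *ₙ k))
  expPartial-taylor k zero _ = refl
  expPartial-taylor k (suc n) k1 = cong₂ _+_ (expPartial-taylor k n k1) (taylor-term (256 *ₙ k *ₙ k) (suc n) (256k²-pos k k1))

  expPartial-nonneg : ∀ k n → 1 ≤ₙ k → 0ℚ ≤ expPartial k n
  expPartial-nonneg k n k1 = subst (0ℚ ≤_) (sym (expPartial-taylor k n k1)) (taylor-nonneg n _ (recip-nonneg (256 *ₙ k *ₙ k)))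

  exp-bound : ∀ k i n → 1 ≤ₙ k → 1 ≤ₙ i → pow (1ℚ - recip (256 *ₙ k *ₙ k *ₙ i)) i * expPartial k n ≤ 1ℚ
  exp-bound k i n k1 i1 = subst (λ z → pow (1ℚ - q) i * z ≤ 1ℚ) (sym (trans (expPartial-taylor k n k1) (cong (taylor n) x≡iq)))
      (decay-vs-taylor n q i (recip-nonneg (X *ₙ i)) (recip≤1 (X *ₙ i) Xi1))
    where
    X : ℕ
    X = 256 *ₙ k *ₙ k
    X1 : 1 ≤ₙ X
    X1 = 256k²-pos k k1
    Xi1 : 1 ≤ₙ X *ₙ i
    Xi1 = ℕP.*-mono-≤ {1} {X} {1} {i} X1 i1
    q : ℚ
    q = recip (X *ₙ i)
    x≡iq : recip X ≡ ι i * q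
    x≡iq = inv-unique _ _ X (recip-inv X X1)
      (trans (solve 3 (λ a r b → (a :* r) :* b := r :* (b :* a)) refl (ι i) q (ι X))
        (trans (cong (q *_) (sym (ι-* X i))) (recip-inv (X *ₙ i) Xi1)))

  -- Locality of the events.  Entry u of a history is fixed once the history has length ≥ u,
  -- so A_{j,u} is determined by the first m·u steps and B_i by the first m·i steps.

  at-zero : ∀ xs → at xs zero ≡ 0
  at-zero [] = refl
  at-zero (x ∷ xs) = refl

  at-++-≤ : ∀ h xs p → p ≤ₙ length h → at (h ++ xs) p ≡ at h p
  at-++-≤ [] xs zero _ = at-zero xs
  at-++-≤ (x ∷ h) xs zero _ = refl
  at-++-≤ (x ∷ h) xs (suc zero) _ = refl
  at-++-≤ (x ∷ h) xs (suc (suc p)) (s≤s le) = at-++-≤ h xs (suc p) le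

  at-last : ∀ h s → at (h ++ [ s ]) (suc (length h)) ≡ s
  at-last [] s = refl
  at-last (x ∷ []) s = refl
  at-last (x ∷ y ∷ h) s = at-last (y ∷ h) s

  any-++ : ∀ {A : Set} (p : A → Bool) xs ys → any p (xs ++ ys) ≡ any p xs ∨ any p ys
  any-++ p [] ys = refl
  any-++ p (x ∷ xs) ys rewrite any-++ p xs ys = sym (BP.∨-assoc (p x) (any p xs) (any p ys))

  any-cong : ∀ {A : Set} (P : A → Set) (p q : A → Bool) xs → All P xs → (∀ x → P x → p x ≡ q x) → any p xs ≡ any q xs
  any-cong P p q [] _ _ = refl
  any-cong P p q (x ∷ xs) (px ∷ pxs) eq = cong₂ _∨_ (eq x px) (any-cong P p q xs pxs eq)

  any-false : ∀ {A : Set} (P : A → Set) (p : A → Bool) xs → All P xs → (∀ x → P x → p x ≡ false) → any p xs ≡ false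
  any-false P p [] _ _ = refl
  any-false P p (x ∷ xs) (px ∷ pxs) eq rewrite eq x px = any-false P p xs pxs eq

  Apair : ℕ → ℕ → ℕ → ℕ → List ℕ → ℕ → Bool
  Apair m a b j h u = (1 ≤ᵇ u) ∧ (j ≤ᵇ u) ∧ edgeIncident m h u 1 a ∧ edgeIncident m h u 2 b

  Aev-suc : ∀ m a b j u h → Aev m a b j (suc u) h ≡ Aev m a b j u h ∨ Apair m a b j h (suc u)
  Aev-suc m a b j u h = trans (cong (any (Apair m a b j h)) (sym (LP.upTo-∷ʳ (suc u))))
    (trans (any-++ (Apair m a b j h) (upTo (suc u)) [ suc u ]) (cong (Aev m a b j u h ∨_) (BP.∨-identityʳ _)))

  Aev-empty : ∀ m a b i h → Aev m a b (i +ₙ 1) i h ≡ false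
  Aev-empty m a b i h = any-false (_<ₙ suc i) (Apair m a b (i +ₙ 1) h) (upTo (suc i)) (all-upTo (suc i))
    (λ u lt → trans (cong (λ z → (1 ≤ᵇ u) ∧ z ∧ _) (≤ᵇ-false (subst (u <ₙ_) (ℕP.+-comm 1 i) lt))) (BP.∧-zeroʳ (1 ≤ᵇ u)))

  Apair-local : ∀ m a b j u h xs → u *ₙ m +ₙ 2 ≤ₙ length h → Apair m a b j (h ++ xs) (suc u) ≡ Apair m a b j h (suc u)
  Apair-local m a b j u h xs le
    rewrite at-++-≤ h xs (u *ₙ m +ₙ 1) (ℕP.≤-trans (ℕP.+-monoʳ-≤ (u *ₙ m) (s≤s z≤n)) le)
          | at-++-≤ h xs (u *ₙ m +ₙ 2) le = refl

  Aev-local : ∀ m a b j u h xs → 2 ≤ₙ m → m *ₙ u ≤ₙ length h → Aev m a b j u (h ++ xs) ≡ Aev m a b j u h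
  Aev-local m a b j u h xs m2 le = any-cong (_<ₙ suc u) _ _ (upTo (suc u)) (all-upTo (suc u)) same
    where
    inside : ∀ v → suc v ≤ₙ u → v *ₙ m +ₙ 2 ≤ₙ length h
    inside v vu = ℕP.≤-trans (ℕP.+-monoʳ-≤ (v *ₙ m) m2)
      (ℕP.≤-trans (ℕP.≤-reflexive (ℕP.+-comm (v *ₙ m) m))
      (ℕP.≤-trans (ℕP.*-monoˡ-≤ m vu) (ℕP.≤-trans (ℕP.≤-reflexive (ℕP.*-comm u m)) le)))
    same : ∀ v → v <ₙ suc u → Apair m a b j (h ++ xs) v ≡ Apair m a b j h v
    same zero _ = refl
    same (suc v) (s≤s vu) = Apair-local m a b j v h xs (inside v vu)

  Bev-local : ∀ m k a b i h xs → m *ₙ i ≤ₙ length h → Bev m k a b i (h ++ xs) ≡ Bev m k a b i h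
  Bev-local m k a b i h xs le rewrite take-++-≤ (m *ₙ i) h xs le = refl

  -- Degrees.  `mergedDeg m h a` is the degree of v_a in the merged graph built from the whole
  -- history h, so that degm m i h a = mergedDeg m (take (m·i) h) a.

  mergedDeg : ℕ → List ℕ → ℕ → ℕ
  mergedDeg m h a = sumℕ1 m (λ r → deg1 h ((a ∸ 1) *ₙ m +ₙ r))

  count-take : ∀ n s h → count s (take n h) ≤ₙ count s h
  count-take zero s h = z≤n
  count-take (suc n) s [] = z≤n
  count-take (suc n) s (x ∷ h) = ℕP.+-monoʳ-≤ (indicator x s) (count-take n s h)

  count-++ : ∀ s h xs → count s h ≤ₙ count s (h ++ xs)
  count-++ s [] xs = z≤n
  count-++ s (x ∷ h) xs = ℕP.+-monoʳ-≤ (indicator x s) (count-++ s h xs)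

  count-absent : ∀ s xs → All (_<ₙ s) xs → count s xs ≡ 0
  count-absent s [] _ = refl
  count-absent s (x ∷ xs) (lt ∷ al) rewrite ≡ᵇ-false x s (λ e → ℕP.<-irrefl e lt) = count-absent s xs al

  born-mono : ∀ s L L' → L ≤ₙ L' → (if (1 ≤ᵇ s) ∧ (s ≤ᵇ L) then 1 else 0) ≤ₙ (if (1 ≤ᵇ s) ∧ (s ≤ᵇ L') then 1 else 0)
  born-mono s L L' le with 1 ≤ᵇ s
  ... | false = z≤n
  ... | true with s ≤ᵇ L in e
  ...   | false = z≤n
  ...   | true rewrite ≤ᵇ-true (ℕP.≤-trans (ℕP.≤ᵇ⇒≤ s L (≡→T e)) le) = ℕP.≤-refl

  deg1-mono : ∀ h h' s → length h ≤ₙ length h' → count s h ≤ₙ count s h' → deg1 h s ≤ₙ deg1 h' s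
  deg1-mono h h' s l c = ℕP.+-mono-≤ (born-mono s (length h) (length h') l) c

  mergedDeg-take : ∀ m n h a → mergedDeg m (take n h) a ≤ₙ mergedDeg m h a
  mergedDeg-take m n h a = sumℕ1-mono m _ _ (λ r →
    deg1-mono (take n h) h _ (subst (_≤ₙ length h) (sym (LP.length-take n h)) (ℕP.m⊓n≤n n (length h))) (count-take n _ h))

  mergedDeg-++ : ∀ m h xs a → mergedDeg m h a ≤ₙ mergedDeg m (h ++ xs) a
  mergedDeg-++ m h xs a = sumℕ1-mono m _ _ (λ r → deg1-mono h (h ++ xs) _
    (subst (length h ≤ₙ_) (sym (LP.length-++ h)) (ℕP.m≤m+n (length h) (length xs))) (count-++ _ h xs))

  LargeDeg : ℕ → ℕ → ℕ → ℕ → Set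
  LargeDeg m k i d = m *ₙ m *ₙ i ≤ₙ (4 *ₙ k *ₙ d) *ₙ (4 *ₙ k *ₙ d)

  Bev-large : ∀ m k a b i h → Bev m k a b i h ≡ true → LargeDeg m k i (degm m i h a) × LargeDeg m k i (degm m i h b)
  Bev-large m k a b i h eq with Equivalence.to BP.T-∧ (≡→T eq)
  ... | pa , pb = ℕP.≤ᵇ⇒≤ _ _ pa , ℕP.≤ᵇ⇒≤ _ _ pb

  degm-unborn : ∀ m i h a → Prefix-bounded h → i <ₙ a → degm m i h a ≡ 0
  degm-unborn m i h a pos lt = trans (sumℕ1-cong m _ (λ _ → 0) vanish) (sumℕ1-zero m)
    where
    later : ∀ r → 1 ≤ₙ r → m *ₙ i <ₙ (a ∸ 1) *ₙ m +ₙ r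
    later r r1 = ℕP.≤-trans (s≤s (ℕP.≤-trans (ℕP.≤-reflexive (ℕP.*-comm m i)) (ℕP.*-monoˡ-≤ m (ℕP.∸-monoˡ-≤ 1 lt))))
                  (ℕP.≤-trans (ℕP.≤-reflexive (ℕP.+-comm 1 _)) (ℕP.+-monoʳ-≤ ((a ∸ 1) *ₙ m) r1))
    short : length (take (m *ₙ i) h) ≤ₙ m *ₙ i
    short = subst (_≤ₙ m *ₙ i) (sym (LP.length-take (m *ₙ i) h)) (ℕP.m⊓n≤m (m *ₙ i) (length h))
    vanish : ∀ r → 1 ≤ₙ r → r ≤ₙ m → deg1 (take (m *ₙ i) h) ((a ∸ 1) *ₙ m +ₙ r) ≡ 0
    vanish r r1 _ rewrite ≤ᵇ-false {(a ∸ 1) *ₙ m +ₙ r} {length (take (m *ₙ i) h)} (ℕP.≤-<-trans short (later r r1))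
                      | BP.∧-zeroʳ (1 ≤ᵇ ((a ∸ 1) *ₙ m +ₙ r)) =
      count-absent _ (take (m *ₙ i) h) (All.map (λ x≤ → ℕP.≤-<-trans x≤ (later r r1)) (pos (m *ₙ i)))

  LargeDeg-born : ∀ m k a i h → Prefix-bounded h → 1 ≤ₙ m → 1 ≤ₙ i → LargeDeg m k i (degm m i h a) → a ≤ₙ i
  LargeDeg-born m k a i h pos m1 i1 large with a ℕ.≤? i
  ... | yes a≤i = a≤i
  ... | no a≰i = ⊥-elim (ℕP.<-irrefl refl (ℕP.≤-trans threshold-pos (ℕP.≤-trans (subst (LargeDeg m k i) (degm-unborn m i h a pos (ℕP.≰⇒> a≰i)) large)
                  (ℕP.≤-reflexive (cong (λ z → z *ₙ z) (ℕP.*-zeroʳ (4 *ₙ k)))))))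
    where
    threshold-pos : 1 ≤ₙ m *ₙ m *ₙ i
    threshold-pos = ℕP.*-mono-≤ {1} {m *ₙ m} {1} {i} (ℕP.*-mono-≤ {1} {m} {1} {m} m1 m1) i1

  -- If v_a is already complete at time n
  -- (a·m ≤ n), the probability that v'_{n+1} attaches to one of v'_{(a-1)m+1..am} is
  -- d(v_a)/(2n+1).

  onGroup : ℕ → ℕ → (ℕ → ℕ) → ℕ → ℕ
  onGroup m a g s = if inGroup m a s then g s else 0

  onGroup-above : ∀ m a g s → a *ₙ m <ₙ s → onGroup m a g s ≡ 0
  onGroup-above m a g s lt rewrite ≤ᵇ-false {s} {a *ₙ m} lt | BP.∧-zeroʳ ((a ∸ 1) *ₙ m <ᵇ s) = refl

  onGroup-inside : ∀ m a g s → (a ∸ 1) *ₙ m <ₙ s → s ≤ₙ a *ₙ m → onGroup m a g s ≡ g s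
  onGroup-inside m a g s p q rewrite <ᵇ-true p | ≤ᵇ-true q = refl

  onGroup-below : ∀ m a g s → s ≤ₙ (a ∸ 1) *ₙ m → onGroup m a g s ≡ 0
  onGroup-below m a g s le rewrite <ᵇ-false le = refl

  sum-onGroup-beyond : ∀ m a g e → sumℕ1 (a *ₙ m +ₙ e) (onGroup m a g) ≡ sumℕ1 (a *ₙ m) (onGroup m a g)
  sum-onGroup-beyond m a g zero = cong (λ T → sumℕ1 T (onGroup m a g)) (ℕP.+-identityʳ (a *ₙ m))
  sum-onGroup-beyond m a g (suc e) = trans (cong (λ T → sumℕ1 T (onGroup m a g)) (ℕP.+-suc (a *ₙ m) e))
    (trans (cong₂ _+ₙ_ (sum-onGroup-beyond m a g e) (onGroup-above m a g (suc (a *ₙ m +ₙ e)) (s≤s (ℕP.m≤m+n (a *ₙ m) e))))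
           (ℕP.+-identityʳ _))

  sum-onGroup-within : ∀ m a' g r → r ≤ₙ m → sumℕ1 (a' *ₙ m +ₙ r) (onGroup m (suc a') g) ≡ sumℕ1 r (λ r → g (a' *ₙ m +ₙ r))
  sum-onGroup-within m a' g zero _ = trans (cong (λ T → sumℕ1 T (onGroup m (suc a') g)) (ℕP.+-identityʳ (a' *ₙ m)))
    (trans (sumℕ1-cong (a' *ₙ m) (onGroup m (suc a') g) (λ _ → 0) (λ s _ le → onGroup-below m (suc a') g s le)) (sumℕ1-zero (a' *ₙ m)))
  sum-onGroup-within m a' g (suc r) le = trans (cong (λ T → sumℕ1 T (onGroup m (suc a') g)) (ℕP.+-suc base r))
    (cong₂ _+ₙ_ (sum-onGroup-within m a' g r (ℕP.<⇒≤ le))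
      (trans (onGroup-inside m (suc a') g (suc (base +ₙ r)) (s≤s (ℕP.m≤m+n base r)) inside) (cong g (sym (ℕP.+-suc base r)))))
    where
    base : ℕ
    base = a' *ₙ m
    inside : suc (base +ₙ r) ≤ₙ suc a' *ₙ m
    inside = subst (suc (base +ₙ r) ≤ₙ_) (ℕP.+-comm base m) (subst (_≤ₙ base +ₙ m) (ℕP.+-suc base r) (ℕP.+-monoʳ-≤ base le))

  sum-onGroup : ∀ m a g T → 1 ≤ₙ a → a *ₙ m ≤ₙ T → sumℕ1 T (onGroup m a g) ≡ sumℕ1 m (λ r → g ((a ∸ 1) *ₙ m +ₙ r))
  sum-onGroup m (suc a') g T _ le = trans (cong (λ T → sumℕ1 T (onGroup m (suc a') g)) (sym (ℕP.m+[n∸m]≡n le)))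
    (trans (sum-onGroup-beyond m (suc a') g (T ∸ (suc a' *ₙ m)))
    (trans (cong (λ T → sumℕ1 T (onGroup m (suc a') g)) (ℕP.+-comm m (a' *ₙ m))) (sum-onGroup-within m a' g m ℕP.≤-refl)))

  frac-ind : ∀ x b d → frac x d * ind b ≡ frac (if b then x else 0) d
  frac-ind x true d = *-identityʳ (frac x d)
  frac-ind x false d = trans (*-zeroʳ (frac x d)) (sym (frac-zero d))

  attach-prob : ∀ m a n h → 1 ≤ₙ a → a *ₙ m ≤ₙ n → Valid n h →
                K n h (λ h' → ind (inGroup m a (at h' (suc n)))) ≡ frac (mergedDeg m h a) (2 *ₙ n)
  attach-prob m a n h a1 am≤n v@((len , _) , _) = begin
    K n h (λ h' → ind (inGroup m a (at h' (suc n))))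
      ≡⟨ K-as-sum n h (λ h' → ind (inGroup m a (at h' (suc n)))) len ⟩
    sumℚ1 (suc n) (λ s → frac (weight h s) (2 *ₙ n) * ind (inGroup m a (at (h ++ [ s ]) (suc n))))
      ≡⟨ sumℚ1-cong (suc n) _ _ (λ s _ _ → trans (cong (λ z → frac (weight h s) (2 *ₙ n) * ind (inGroup m a z)) (last s))
                                                  (frac-ind (weight h s) (inGroup m a s) (2 *ₙ n))) ⟩
    sumℚ1 (suc n) (λ s → frac (onGroup m a (weight h) s) (2 *ₙ n))
      ≡⟨ sumℚ1-frac (suc n) (onGroup m a (weight h)) (2 *ₙ n) ⟩
    frac (sumℕ1 (suc n) (onGroup m a (weight h))) (2 *ₙ n)
      ≡⟨ cong (λ z → frac z (2 *ₙ n)) (sumℕ1-cong (suc n) _ _ old) ⟩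
    frac (sumℕ1 (suc n) (onGroup m a (deg1 h))) (2 *ₙ n)
      ≡⟨ cong (λ z → frac z (2 *ₙ n)) (sum-onGroup m a (deg1 h) (suc n) a1 (ℕP.m≤n⇒m≤1+n am≤n)) ⟩
    frac (mergedDeg m h a) (2 *ₙ n) ∎
    where
    open ≡-Reasoning
    last : ∀ s → at (h ++ [ s ]) (suc n) ≡ s
    last s = trans (cong (λ z → at (h ++ [ s ]) (suc z)) (sym len)) (at-last h s)
    s≤am : ∀ {s} → inGroup m a s ≡ true → s ≤ₙ a *ₙ m
    s≤am {s} eq = ℕP.≤ᵇ⇒≤ s (a *ₙ m) (≡→T (∧-true-right _ _ eq))
    -- the group of v_a does not contain the new vertex v'_{n+1}, whose weight is 1
    old : ∀ s → 1 ≤ₙ s → s ≤ₙ suc n → onGroup m a (weight h) s ≡ onGroup m a (deg1 h) s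
    old s _ _ with inGroup m a s in eq
    ... | false = refl
    ... | true rewrite len | ≡ᵇ-false s (suc n) (λ e → ℕP.<-irrefl e (s≤s (ℕP.≤-trans (s≤am eq) am≤n))) = refl

  avoid-prob : ∀ m a n h → 1 ≤ₙ a → a *ₙ m ≤ₙ n → Valid n h →
               K n h (λ h' → ind (not (inGroup m a (at h' (suc n))))) ≡ 1ℚ - frac (mergedDeg m h a) (2 *ₙ n)
  avoid-prob m a n h a1 am≤n v = begin
    K n h (λ h' → ind (not (landing h')))
      ≡⟨ K-cong n h (λ h' → ind (not (landing h'))) (λ h' → 1ℚ + (- 1ℚ) * ind (landing h')) (λ s _ _ → ind-not (landing (h ++ [ s ]))) ⟩
    K n h (λ h' → 1ℚ + (- 1ℚ) * ind (landing h'))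
      ≡⟨ K-affine n h 1ℚ (- 1ℚ) (λ h' → ind (landing h')) v ⟩
    1ℚ + (- 1ℚ) * K n h (λ h' → ind (landing h'))
      ≡⟨ cong (λ z → 1ℚ + (- 1ℚ) * z) (attach-prob m a n h a1 am≤n v) ⟩
    1ℚ + (- 1ℚ) * frac (mergedDeg m h a) (2 *ₙ n)
      ≡⟨ solve 1 (λ p → con 1ℚ :+ (:- con 1ℚ) :* p := con 1ℚ :- p) refl (frac (mergedDeg m h a) (2 *ₙ n)) ⟩
    1ℚ - frac (mergedDeg m h a) (2 *ₙ n) ∎
    where
    open ≡-Reasoning
    landing : List ℕ → Bool
    landing h' = inGroup m a (at h' (suc n))

  -- On B_i, d_a d_b ≥ m²i/(16k²); while u < 2i the denominators
  -- 2L+1 and 2L+3 (L = m·u) are at most 4mi.  Hence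
  --   (2L+1)(2L+3) ≤ 16m²i² ≤ 256 k² i · d_a d_b,  i.e.  q ≤ d_b/(2L+3) · d_a/(2L+1).

  square-cancel : ∀ x y → x *ₙ x ≤ₙ y *ₙ y → x ≤ₙ y
  square-cancel x y le with x ℕ.≤? y
  ... | yes x≤y = x≤y
  ... | no x≰y = ⊥-elim (ℕP.<⇒≱ (ℕP.*-mono-< (ℕP.≰⇒> x≰y) (ℕP.≰⇒> x≰y)) le)

  -- the geometric mean of the two thresholds: m²i ≤ 16k² d_a d_b
  LargeDeg-product : ∀ m k i da db → LargeDeg m k i da → LargeDeg m k i db → m *ₙ m *ₙ i ≤ₙ 16 *ₙ k *ₙ k *ₙ da *ₙ db
  LargeDeg-product m k i da db la lb = square-cancel _ _ (ℕP.≤-trans (ℕP.*-mono-≤ la lb) (ℕP.≤-reflexive (squares k da db)))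
    where
    squares : ∀ k da db → ((4 *ₙ k *ₙ da) *ₙ (4 *ₙ k *ₙ da)) *ₙ ((4 *ₙ k *ₙ db) *ₙ (4 *ₙ k *ₙ db))
                          ≡ (16 *ₙ k *ₙ k *ₙ da *ₙ db) *ₙ (16 *ₙ k *ₙ k *ₙ da *ₙ db)
    squares = solve-∀

  denominator-bound : ∀ m i u → 2 ≤ₙ m → suc u ≤ₙ 2 *ₙ i → suc (2 *ₙ suc (m *ₙ u)) ≤ₙ 4 *ₙ m *ₙ i
  denominator-bound m i u m2 ui = begin
    suc (2 *ₙ suc L)   ≡⟨ id₁ L ⟩
    2 *ₙ L +ₙ 3        ≤⟨ ℕP.+-monoʳ-≤ (2 *ₙ L) (ℕP.≤-trans (s≤s (s≤s (s≤s z≤n))) (ℕP.*-monoʳ-≤ 2 m2)) ⟩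
    2 *ₙ L +ₙ 2 *ₙ m   ≡⟨ id₂ m u ⟩
    2 *ₙ m *ₙ suc u    ≤⟨ ℕP.*-monoʳ-≤ (2 *ₙ m) ui ⟩
    2 *ₙ m *ₙ (2 *ₙ i) ≡⟨ id₃ m i ⟩
    4 *ₙ m *ₙ i        ∎
    where
    open ℕP.≤-Reasoning
    L : ℕ
    L = m *ₙ u
    id₁ : ∀ L → suc (2 *ₙ suc L) ≡ 2 *ₙ L +ₙ 3
    id₁ = solve-∀
    id₂ : ∀ m u → 2 *ₙ (m *ₙ u) +ₙ 2 *ₙ m ≡ 2 *ₙ m *ₙ suc u
    id₂ = solve-∀
    id₃ : ∀ m i → 2 *ₙ m *ₙ (2 *ₙ i) ≡ 4 *ₙ m *ₙ i
    id₃ = solve-∀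

  attach-product-bound : ∀ m k i u da db → 2 ≤ₙ m → suc u ≤ₙ 2 *ₙ i → LargeDeg m k i da → LargeDeg m k i db →
    suc (2 *ₙ (m *ₙ u)) *ₙ suc (2 *ₙ suc (m *ₙ u)) ≤ₙ (db *ₙ da) *ₙ (256 *ₙ k *ₙ k *ₙ i)
  attach-product-bound m k i u da db m2 ui la lb = begin
    suc (2 *ₙ L) *ₙ suc (2 *ₙ suc L)
      ≤⟨ ℕP.*-mono-≤ (ℕP.≤-trans (s≤s (ℕP.*-monoʳ-≤ 2 (ℕP.n≤1+n L))) bound) bound ⟩
    (4 *ₙ m *ₙ i) *ₙ (4 *ₙ m *ₙ i)
      ≡⟨ id₁ m i ⟩
    16 *ₙ i *ₙ (m *ₙ m *ₙ i)
      ≤⟨ ℕP.*-monoʳ-≤ (16 *ₙ i) (LargeDeg-product m k i da db la lb) ⟩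
    16 *ₙ i *ₙ (16 *ₙ k *ₙ k *ₙ da *ₙ db)
      ≡⟨ id₂ i k da db ⟩
    (db *ₙ da) *ₙ (256 *ₙ k *ₙ k *ₙ i) ∎
    where
    open ℕP.≤-Reasoning
    L : ℕ
    L = m *ₙ u
    bound : suc (2 *ₙ suc L) ≤ₙ 4 *ₙ m *ₙ i
    bound = denominator-bound m i u m2 ui
    id₁ : ∀ m i → (4 *ₙ m *ₙ i) *ₙ (4 *ₙ m *ₙ i) ≡ 16 *ₙ i *ₙ (m *ₙ m *ₙ i)
    id₁ = solve-∀
    id₂ : ∀ i k da db → 16 *ₙ i *ₙ (16 *ₙ k *ₙ k *ₙ da *ₙ db) ≡ (db *ₙ da) *ₙ (256 *ₙ k *ₙ k *ₙ i)
    id₂ = solve-∀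

  q≤attach-product : ∀ N L da db → 1 ≤ₙ N → suc (2 *ₙ L) *ₙ suc (2 *ₙ suc L) ≤ₙ (db *ₙ da) *ₙ N →
                     recip N ≤ frac db (2 *ₙ suc L) * frac da (2 *ₙ L)
  q≤attach-product N L da db N1 le = subst₂ _≤_ (sym (recip-frac N N1)) (sym product)
      (frac-≤ 1 (N ∸ 1) (db *ₙ da) D (subst₂ _≤ₙ_ (sym (ℕP.+-identityʳ (suc D))) (cong ((db *ₙ da) *ₙ_) (sym (ℕP.m+[n∸m]≡n N1))) le))
    where
    D₁ D₂ D : ℕ
    D₁ = 2 *ₙ L
    D₂ = 2 *ₙ suc L
    -- (D₁+1)(D₂+1) = D + 1
    D = D₂ +ₙ D₁ *ₙ suc D₂
    reciprocals : frac 1 D₁ * frac 1 D₂ ≡ frac 1 D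
    reciprocals = inv-unique _ _ (suc D₁ *ₙ suc D₂) (inv-* (frac 1 D₁) (frac 1 D₂) (suc D₁) (suc D₂) (frac-inv D₁) (frac-inv D₂)) (frac-inv D)
    product : frac db D₂ * frac da D₁ ≡ frac (db *ₙ da) D
    product = begin
      frac db D₂ * frac da D₁                  ≡⟨ cong₂ _*_ (frac-split db D₂) (frac-split da D₁) ⟩
      (ι db * frac 1 D₂) * (ι da * frac 1 D₁)
        ≡⟨ solve 4 (λ a r b s → (a :* r) :* (b :* s) := (a :* b) :* (s :* r)) refl (ι db) (frac 1 D₂) (ι da) (frac 1 D₁) ⟩
      (ι db * ι da) * (frac 1 D₁ * frac 1 D₂)  ≡⟨ cong₂ _*_ (sym (ι-* db da)) reciprocals ⟩
      ι (db *ₙ da) * frac 1 D                  ≡⟨ sym (frac-split (db *ₙ da) D) ⟩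
      frac (db *ₙ da) D                        ∎
      where open ≡-Reasoning

  module Decay (m k a b i j : ℕ) (m2 : 2 ≤ₙ m) (k1 : 1 ≤ₙ k) (i1 : 1 ≤ₙ i) (a1 : 1 ≤ₙ a) (b1 : 1 ≤ₙ b) where

    C : List ℕ → Bool
    C h = not (Aev m a b j i h) ∧ Bev m k a b i h

    F : ℕ → List ℕ → Bool
    F u h = not (Aev m a b (i +ₙ 1) u h) ∧ C h

    q : ℚ
    q = recip (256 *ₙ k *ₙ k *ₙ i)

    256k²i-pos : 1 ≤ₙ 256 *ₙ k *ₙ k *ₙ i
    256k²i-pos = ℕP.*-mono-≤ {1} {256 *ₙ k *ₙ k} {1} {i} (256k²-pos k k1) i1

    mi≤mu : ∀ {u} → i ≤ₙ u → m *ₙ i ≤ₙ m *ₙ u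
    mi≤mu = ℕP.*-monoʳ-≤ m

    -- C is decided by time m·i, F_{u+1} by time m·u + 2 (the first two edges of v_{u+1})
    C-local : ∀ h xs → m *ₙ i ≤ₙ length h → C (h ++ xs) ≡ C h
    C-local h xs le rewrite Aev-local m a b j i h xs m2 le | Bev-local m k a b i h xs le = refl

    F-suc-local : ∀ u h xs → i ≤ₙ u → m *ₙ u +ₙ 2 ≤ₙ length h → F (suc u) (h ++ xs) ≡ F (suc u) h
    F-suc-local u h xs iu le
      rewrite Aev-suc m a b (i +ₙ 1) u (h ++ xs) | Aev-suc m a b (i +ₙ 1) u h
            | Aev-local m a b (i +ₙ 1) u h xs m2 (ℕP.≤-trans (ℕP.m≤m+n (m *ₙ u) 2) le)
            | Apair-local m a b (i +ₙ 1) u h xs (subst (λ z → z +ₙ 2 ≤ₙ length h) (ℕP.*-comm m u) le)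
            | C-local h xs (ℕP.≤-trans (mi≤mu iu) (ℕP.≤-trans (ℕP.m≤m+n (m *ₙ u) 2) le)) = refl

    -- the edge of v_{u+1} that ends at v'_s is incident to v_x
    lands : ℕ → ℕ → ℕ → Bool
    lands u x s = (suc u ≡ᵇ x) ∨ inGroup m x s

    F-next : ∀ u h s₁ s₂ → length h ≡ m *ₙ u → i ≤ₙ u →
             F (suc u) ((h ++ [ s₁ ]) ++ [ s₂ ]) ≡ not (Aev m a b (i +ₙ 1) u h ∨ (lands u a s₁ ∧ lands u b s₂)) ∧ C h
    F-next u h s₁ s₂ len iu = cong₂ (λ x y → not x ∧ y)
        (trans (Aev-suc m a b (i +ₙ 1) u h₂) (cong₂ _∨_ (trans (cong (Aev m a b (i +ₙ 1) u) assoc)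
                                                          (Aev-local m a b (i +ₙ 1) u h (s₁ ∷ s₂ ∷ []) m2 (ℕP.≤-reflexive (sym len)))) pair))
        (trans (cong C assoc) (C-local h (s₁ ∷ s₂ ∷ []) (ℕP.≤-trans (mi≤mu iu) (ℕP.≤-reflexive (sym len)))))
      where
      h₁ h₂ : List ℕ
      h₁ = h ++ [ s₁ ]
      h₂ = h₁ ++ [ s₂ ]
      assoc : h₂ ≡ h ++ s₁ ∷ s₂ ∷ []
      assoc = LP.++-assoc h [ s₁ ] [ s₂ ]
      um : u *ₙ m ≡ length h
      um = trans (ℕP.*-comm u m) (sym len)
      first : at h₂ (u *ₙ m +ₙ 1) ≡ s₁
      first = begin
        at (h₁ ++ [ s₂ ]) (u *ₙ m +ₙ 1) ≡⟨ at-++-≤ h₁ [ s₂ ] (u *ₙ m +ₙ 1) (ℕP.≤-reflexive (trans (ℕP.+-comm (u *ₙ m) 1) (trans (cong suc um) (sym (length-snoc h s₁))))) ⟩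
        at h₁ (u *ₙ m +ₙ 1)             ≡⟨ cong (at h₁) (trans (ℕP.+-comm (u *ₙ m) 1) (cong suc um)) ⟩
        at h₁ (suc (length h))          ≡⟨ at-last h s₁ ⟩
        s₁                              ∎
        where open ≡-Reasoning
      second : at h₂ (u *ₙ m +ₙ 2) ≡ s₂
      second = begin
        at (h₁ ++ [ s₂ ]) (u *ₙ m +ₙ 2) ≡⟨ cong (at (h₁ ++ [ s₂ ])) (trans (ℕP.+-comm (u *ₙ m) 2) (cong (λ z → suc (suc z)) um)) ⟩
        at (h₁ ++ [ s₂ ]) (suc (suc (length h))) ≡⟨ cong (λ z → at (h₁ ++ [ s₂ ]) (suc z)) (sym (length-snoc h s₁)) ⟩
        at (h₁ ++ [ s₂ ]) (suc (length h₁)) ≡⟨ at-last h₁ s₂ ⟩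
        s₂                              ∎
        where open ≡-Reasoning
      pair : Apair m a b (i +ₙ 1) h₂ (suc u) ≡ lands u a s₁ ∧ lands u b s₂
      pair rewrite first | second | ≤ᵇ-true {i +ₙ 1} {suc u} (subst (_≤ₙ suc u) (ℕP.+-comm 1 i) (s≤s iu)) = refl

    F-next-dead : ∀ A P c → not A ∧ c ≡ false → not (A ∨ P) ∧ c ≡ false
    F-next-dead true P c _ = refl
    F-next-dead false P c e rewrite e = BP.∧-zeroʳ (not P)

    G : ℕ → List ℕ → ℚ
    G u h = ind (F u h)

    -- One block: the two decisive steps m·u → m·u + 2, starting from a valid history h.
    module Block (u : ℕ) (h : List ℕ) (iu : i ≤ₙ u) (v : Valid (m *ₙ u) h) where

      L : ℕ
      L = m *ₙ u

      len : length h ≡ L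
      len = proj₁ (proj₁ v)

      twoStep : ℚ
      twoStep = K L h (λ h₁ → K (suc L) h₁ (G (suc u)))

      dead : F u h ≡ false → twoStep ≡ 0ℚ
      dead eF = K-const L h (λ h₁ → K (suc L) h₁ (G (suc u))) 0ℚ v (λ s₁ p₁ q₁ → K-const (suc L) (h ++ [ s₁ ]) (G (suc u)) 0ℚ (Valid-snoc L h s₁ v p₁ q₁)
        (λ s₂ _ _ → cong ind (trans (F-next u h s₁ s₂ len iu) (F-next-dead (Aev m a b (i +ₙ 1) u h) (lands u a s₁ ∧ lands u b s₂) (C h) eF))))

      -- When F_u holds, F_{u+1} fails exactly when the first edge of v_{u+1} hits v_a and the
      -- second hits v_b; this has probability ≥ q.
      module Alive (ui : suc u ≤ₙ 2 *ₙ i) (eA : Aev m a b (i +ₙ 1) u h ≡ false) (eC : C h ≡ true) where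

        da db : ℕ
        da = degm m i h a
        db = degm m i h b

        large : LargeDeg m k i da × LargeDeg m k i db
        large = Bev-large m k a b i h (∧-true-right (not (Aev m a b j i h)) _ eC)

        a≤i : a ≤ₙ i
        a≤i = LargeDeg-born m k a i h (proj₂ v) (ℕP.≤-trans (s≤s z≤n) m2) i1 (proj₁ large)

        b≤i : b ≤ₙ i
        b≤i = LargeDeg-born m k b i h (proj₂ v) (ℕP.≤-trans (s≤s z≤n) m2) i1 (proj₂ large)

        complete : ∀ {x} → x ≤ₙ i → x *ₙ m ≤ₙ L
        complete xi = ℕP.≤-trans (ℕP.*-monoˡ-≤ m (ℕP.≤-trans xi iu)) (ℕP.≤-reflexive (ℕP.*-comm u m))

        -- v_{u+1} is none of v_a, v_b
        lands-old : ∀ x → x ≤ₙ i → ∀ s → lands u x s ≡ inGroup m x s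
        lands-old x xi s rewrite ≡ᵇ-false (suc u) x (λ e → ℕP.<-irrefl refl (ℕP.≤-trans (s≤s iu) (ℕP.≤-trans (ℕP.≤-reflexive e) xi))) = refl

        F-next-alive : ∀ s₁ s₂ → F (suc u) ((h ++ [ s₁ ]) ++ [ s₂ ]) ≡ not (inGroup m a s₁ ∧ inGroup m b s₂)
        F-next-alive s₁ s₂ rewrite F-next u h s₁ s₂ len iu | eA | eC | lands-old a a≤i s₁ | lands-old b b≤i s₂ = BP.∧-identityʳ _

        β α : ℚ
        β = frac db (2 *ₙ suc L)
        α = frac (mergedDeg m h a) (2 *ₙ L)

        q≤βα : q ≤ β * α
        q≤βα = ≤-trans (q≤attach-product _ L da db 256k²i-pos (attach-product-bound m k i u da db m2 ui (proj₁ large) (proj₂ large)))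
          (*-monoˡ-nonneg (frac-nonneg db (2 *ₙ suc L)) (frac-≤ da _ (mergedDeg m h a) _ (ℕP.*-monoˡ-≤ (suc (2 *ₙ L)) (mergedDeg-take m (m *ₙ i) h a))))

        second-edge : ∀ s₁ → 1 ≤ₙ s₁ → s₁ ≤ₙ suc L → ∀ x →
          K (suc L) (h ++ [ s₁ ]) (λ h₂ → ind (not (x ∧ inGroup m b (at h₂ (suc (suc L)))))) ≤ 1ℚ + (- β) * ind x
        second-edge s₁ p₁ q₁ false = ≤-reflexive (trans (K-const (suc L) (h ++ [ s₁ ]) (λ _ → 1ℚ) 1ℚ (Valid-snoc L h s₁ v p₁ q₁) (λ _ _ _ → refl))
          (solve 1 (λ β → con 1ℚ := con 1ℚ :+ (:- β) :* con 0ℚ) refl β))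
        second-edge s₁ p₁ q₁ true = begin
          K (suc L) (h ++ [ s₁ ]) (λ h₂ → ind (not (inGroup m b (at h₂ (suc (suc L))))))
            ≡⟨ avoid-prob m b (suc L) (h ++ [ s₁ ]) b1 (ℕP.m≤n⇒m≤1+n (complete b≤i)) (Valid-snoc L h s₁ v p₁ q₁) ⟩
          1ℚ - frac (mergedDeg m (h ++ [ s₁ ]) b) (2 *ₙ suc L)
            ≤⟨ +-monoʳ-≤ 1ℚ (neg-antimono-≤ (frac-≤ db (2 *ₙ suc L) (mergedDeg m (h ++ [ s₁ ]) b) (2 *ₙ suc L) (ℕP.*-monoˡ-≤ (suc (2 *ₙ suc L))
                 (ℕP.≤-trans (mergedDeg-take m (m *ₙ i) h b) (mergedDeg-++ m h [ s₁ ] b))))) ⟩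
          1ℚ - β
            ≡⟨ solve 1 (λ β → con 1ℚ :- β := con 1ℚ :+ (:- β) :* con 1ℚ) refl β ⟩
          1ℚ + (- β) * 1ℚ ∎
          where open ≤-Reasoning

        at-new : ∀ n h' s → length h' ≡ n → at (h' ++ [ s ]) (suc n) ≡ s
        at-new n h' s len' = trans (cong (λ z → at (h' ++ [ s ]) (suc z)) (sym len')) (at-last h' s)

        after-first : ∀ s₁ → 1 ≤ₙ s₁ → s₁ ≤ₙ suc L → K (suc L) (h ++ [ s₁ ]) (G (suc u)) ≤ 1ℚ + (- β) * ind (inGroup m a s₁)
        after-first s₁ p₁ q₁ = ≤-trans
          (≤-reflexive (K-cong (suc L) (h ++ [ s₁ ]) (G (suc u)) (λ h₂ → ind (not (inGroup m a s₁ ∧ inGroup m b (at h₂ (suc (suc L))))))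
            (λ s₂ _ _ → cong ind (trans (F-next-alive s₁ s₂)
               (cong (λ z → not (inGroup m a s₁ ∧ inGroup m b z)) (sym (at-new (suc L) (h ++ [ s₁ ]) s₂ (trans (length-snoc h s₁) (cong suc len)))))))))
          (second-edge s₁ p₁ q₁ (inGroup m a s₁))

        -- the first edge, averaged against the bound for the second
        alive : twoStep ≤ 1ℚ - q
        alive = begin
          twoStep
            ≤⟨ K-mono L h (λ h₁ → K (suc L) h₁ (G (suc u))) (λ h₁ → 1ℚ + (- β) * ind (inGroup m a (at h₁ (suc L))))
                 (λ s₁ p₁ q₁ → subst (λ z → K (suc L) (h ++ [ s₁ ]) (G (suc u)) ≤ 1ℚ + (- β) * ind (inGroup m a z))
                                     (sym (at-new L h s₁ len)) (after-first s₁ p₁ q₁)) ⟩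
          K L h (λ h₁ → 1ℚ + (- β) * ind (inGroup m a (at h₁ (suc L))))
            ≡⟨ K-affine L h 1ℚ (- β) (λ h₁ → ind (inGroup m a (at h₁ (suc L)))) v ⟩
          1ℚ + (- β) * K L h (λ h₁ → ind (inGroup m a (at h₁ (suc L))))
            ≡⟨ cong (λ z → 1ℚ + (- β) * z) (attach-prob m a L h a1 (complete a≤i) v) ⟩
          1ℚ + (- β) * α
            ≡⟨ cong (1ℚ +_) (sym (neg-distribˡ-* β α)) ⟩
          1ℚ - β * α
            ≤⟨ +-monoʳ-≤ 1ℚ (neg-antimono-≤ q≤βα) ⟩
          1ℚ - q ∎
          where open ≤-Reasoning

      pointwise : suc u ≤ₙ 2 *ₙ i → twoStep ≤ (1ℚ - q) * G u h
      pointwise ui = by-cases (Aev m a b (i +ₙ 1) u h) refl (C h) refl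
        where
        when-dead : F u h ≡ false → twoStep ≤ (1ℚ - q) * G u h
        when-dead eF = ≤-reflexive (trans (dead eF) (sym (trans (cong (λ z → (1ℚ - q) * ind z) eF) (*-zeroʳ (1ℚ - q)))))
        by-cases : ∀ A → Aev m a b (i +ₙ 1) u h ≡ A → ∀ c → C h ≡ c → twoStep ≤ (1ℚ - q) * G u h
        by-cases false eA true eC = ≤-trans (Alive.alive ui eA eC)
          (≤-reflexive (sym (trans (cong (λ z → (1ℚ - q) * ind z) (cong₂ (λ z w → not z ∧ w) eA eC)) (*-identityʳ (1ℚ - q)))))
        by-cases true eA c eC = when-dead (cong (λ z → not z ∧ C h) eA)
        by-cases false eA false eC = when-dead (cong₂ (λ z w → not z ∧ w) eA eC)

    -- Averaging the pointwise bound: E[F_{u+1}] ≤ (1-q) E[F_u] for i ≤ u < 2i.  Only the two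
    -- steps after time m·u matter; the remaining m-2 steps of v_{u+1} leave F_{u+1} unchanged.
    block-decay : ∀ u → i ≤ₙ u → suc u ≤ₙ 2 *ₙ i → E (m *ₙ suc u) (G (suc u)) ≤ (1ℚ - q) * E (m *ₙ u) (G u)
    block-decay u iu ui = begin
      E (m *ₙ suc u) (G (suc u))                          ≡⟨ cong (λ n → E n (G (suc u))) time ⟩
      E (suc (suc L) +ₙ (m ∸ 2)) (G (suc u))              ≡⟨ E-stable (suc (suc L)) (m ∸ 2) (G (suc u)) stable ⟩
      E (suc (suc L)) (G (suc u))                         ≡⟨ E-step (suc L) (G (suc u)) ⟩
      E (suc L) (λ h₁ → K (suc L) h₁ (G (suc u)))          ≡⟨ E-step L (λ h₁ → K (suc L) h₁ (G (suc u))) ⟩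
      E L (λ h → K L h (λ h₁ → K (suc L) h₁ (G (suc u))))
        ≤⟨ E-mono L _ (λ h → (1ℚ - q) * G u h) (λ h v → Block.pointwise u h iu v ui) ⟩
      E L (λ h → (1ℚ - q) * G u h)                        ≡⟨ E-scale L (1ℚ - q) (G u) ⟩
      (1ℚ - q) * E L (G u)                                ∎
      where
      open ≤-Reasoning
      L : ℕ
      L = m *ₙ u
      time : m *ₙ suc u ≡ suc (suc L) +ₙ (m ∸ 2)
      time = trans (ℕP.*-suc m u) (trans (cong (_+ₙ L) (sym (ℕP.m+[n∸m]≡n m2))) (cong (λ z → suc (suc z)) (ℕP.+-comm (m ∸ 2) L)))
      stable : ∀ n h s → suc (suc L) ≤ₙ n → Valid n h → 1 ≤ₙ s → s ≤ₙ suc n → G (suc u) (h ++ [ s ]) ≡ G (suc u) h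
      stable n h s le v _ _ = cong ind (F-suc-local u h [ s ] iu
        (ℕP.≤-trans (ℕP.≤-reflexive (ℕP.+-comm L 2)) (ℕP.≤-trans le (ℕP.≤-reflexive (sym (proj₁ (proj₁ v)))))))

    -- iterating from F_i = C
    iterate : ∀ t → t ≤ₙ i → E (m *ₙ (i +ₙ t)) (G (i +ₙ t)) ≤ pow (1ℚ - q) t * E (m *ₙ i) (λ h → ind (C h))
    iterate zero _ = ≤-reflexive (trans (cong (λ z → E (m *ₙ z) (G z)) (ℕP.+-identityʳ i))
      (trans (E-cong (m *ₙ i) (G i) (λ h → ind (C h)) (λ h _ → cong (λ z → ind (not z ∧ C h)) (Aev-empty m a b i h)))
             (sym (*-identityˡ _))))
    iterate (suc t) t<i = begin
      E (m *ₙ (i +ₙ suc t)) (G (i +ₙ suc t))        ≡⟨ cong (λ z → E (m *ₙ z) (G z)) (ℕP.+-suc i t) ⟩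
      E (m *ₙ suc (i +ₙ t)) (G (suc (i +ₙ t)))      ≤⟨ block-decay (i +ₙ t) (ℕP.m≤m+n i t) before-2i ⟩
      (1ℚ - q) * E (m *ₙ (i +ₙ t)) (G (i +ₙ t))
        ≤⟨ *-monoˡ-nonneg (one-minus-nonneg q (recip≤1 _ 256k²i-pos)) (iterate t (ℕP.<⇒≤ t<i)) ⟩
      (1ℚ - q) * (pow (1ℚ - q) t * E (m *ₙ i) (λ h → ind (C h)))
        ≡⟨ sym (*-assoc (1ℚ - q) (pow (1ℚ - q) t) _) ⟩
      pow (1ℚ - q) (suc t) * E (m *ₙ i) (λ h → ind (C h)) ∎
      where
      open ≤-Reasoning
      before-2i : suc (i +ₙ t) ≤ₙ 2 *ₙ i
      before-2i = subst₂ _≤ₙ_ (ℕP.+-suc i t) (cong (i +ₙ_) (sym (ℕP.+-identityʳ i))) (ℕP.+-monoʳ-≤ i t<i)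

    decay : Pr (m *ₙ (2 *ₙ i)) (F (2 *ₙ i)) ≤ pow (1ℚ - q) i * Pr (m *ₙ (2 *ₙ i)) C
    decay = begin
      Pr (m *ₙ (2 *ₙ i)) (F (2 *ₙ i))         ≡⟨ Pr-E (m *ₙ (2 *ₙ i)) (F (2 *ₙ i)) ⟩
      E (m *ₙ (2 *ₙ i)) (G (2 *ₙ i))          ≡⟨ cong (λ z → E (m *ₙ z) (G z)) 2i≡i+i ⟩
      E (m *ₙ (i +ₙ i)) (G (i +ₙ i))          ≤⟨ iterate i ℕP.≤-refl ⟩
      pow (1ℚ - q) i * E (m *ₙ i) indC        ≡⟨ cong (pow (1ℚ - q) i *_) (sym (E-stable (m *ₙ i) (m *ₙ i) indC stable)) ⟩
      pow (1ℚ - q) i * E (m *ₙ i +ₙ m *ₙ i) indC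
        ≡⟨ cong (λ z → pow (1ℚ - q) i * E z indC) (trans (sym (ℕP.*-distribˡ-+ m i i)) (cong (m *ₙ_) (sym 2i≡i+i))) ⟩
      pow (1ℚ - q) i * E (m *ₙ (2 *ₙ i)) indC ≡⟨ cong (pow (1ℚ - q) i *_) (sym (Pr-E (m *ₙ (2 *ₙ i)) C)) ⟩
      pow (1ℚ - q) i * Pr (m *ₙ (2 *ₙ i)) C   ∎
      where
      open ≤-Reasoning
      indC : List ℕ → ℚ
      indC h = ind (C h)
      2i≡i+i : 2 *ₙ i ≡ i +ₙ i
      2i≡i+i = cong (i +ₙ_) (ℕP.+-identityʳ i)
      stable : ∀ n h s → m *ₙ i ≤ₙ n → Valid n h → 1 ≤ₙ s → s ≤ₙ suc n → indC (h ++ [ s ]) ≡ indC h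
      stable n h s le v _ _ = cong ind (C-local h [ s ] (ℕP.≤-trans le (ℕP.≤-reflexive (sym (proj₁ (proj₁ v))))))


open import Defs
open import Data.Nat using (ℕ; _≤_; _^_; _*_; _+_)
open import Data.Bool using (not; _∧_)
open import Data.Rational using () renaming (_*_ to _*ℚ_; _≤_ to _≤ℚ_)
open import Data.Rational using (ℚ; 1ℚ; _-_)
open import Data.Rational.Properties using (*-identityˡ; *-assoc; *-comm; module ≤-Reasoning)
open import Relation.Binary.PropositionalEquality using (_≡_; cong; sym; trans)
import Data.Nat as ℕ
import Data.Nat.Properties as ℕP
open Development using (pow; exp-bound; expPartial-nonneg; Pr-nonneg; *-monoʳ-nonneg; module Decay)

lemma15 : (m k a b i j : ℕ) → 2 ≤ m → 1 ≤ k → 1 ≤ a → 1 ≤ b →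
          k ^ 4 ≤ i → j ≤ i → (n : ℕ) →
          Pr (m * (2 * i)) (λ h → not (Aev m a b (i + 1) (2 * i) h) ∧ not (Aev m a b j i h) ∧ Bev m k a b i h)
            *ℚ expPartial k n
          ≤ℚ Pr (m * (2 * i)) (λ h → not (Aev m a b j i h) ∧ Bev m k a b i h)
lemma15 m k a b i j m2 k1 a1 b1 k⁴≤i _ n = begin
    Pr N (F (2 * i)) *ℚ S                  ≤⟨ *-monoʳ-nonneg (expPartial-nonneg k n k1) decay ⟩
    (decayFactor *ℚ Pr N C) *ℚ S           ≡⟨ rearrange decayFactor (Pr N C) S ⟩
    (decayFactor *ℚ S) *ℚ Pr N C           ≤⟨ *-monoʳ-nonneg (Pr-nonneg N C) (exp-bound k i n k1 i≥1) ⟩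
    1ℚ *ℚ Pr N C                           ≡⟨ *-identityˡ (Pr N C) ⟩
    Pr N C                                 ∎
  where
  open ≤-Reasoning
  i≥1 : 1 ≤ i
  i≥1 = ℕP.≤-trans (ℕP.m^n>0 k {{ℕ.>-nonZero k1}} 4) k⁴≤i
  open Decay m k a b i j m2 k1 i≥1 a1 b1
  N : ℕ
  N = m * (2 * i)
  S decayFactor : ℚ
  S = expPartial k n
  decayFactor = pow (1ℚ - q) i
  rearrange : ∀ x y z → (x *ℚ y) *ℚ z ≡ (x *ℚ z) *ℚ y
  rearrange x y z = trans (*-assoc x y z) (trans (cong (x *ℚ_) (*-comm y z)) (sym (*-assoc x z y)))
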